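{- Let $s\ge1$, $r\ge0$, $k\ge\max(r,1)$ and $n\ge sk$ be integers. Then \[ L^{(s)}_r(n,k)=\frac{(n-r)!}{(k-r)!}\sum_{j=0}^{r}\binom{r}{j}\binom{n+j-(s-1)k-1}{k+j-1}(s-1)^{r-j}. \]
   Context: Fix an integer $s\ge1$. For integers $n,k,r\ge0$, $L^{(s)}_r(n,k)$ is the number of partitions of $\{1,\dots,n\}$ into exactly $k$ ordered lists (nonempty blocks each with a linear order, the set of blocks unordered) such that the elements $1,\dots,r$ lie in pairwise distinct lists and every list contains at least $s$ elements. The convention $0^0=1$ is used. -}

module Defs where

open import Data.Bool using (Bool; true; false; _∧_; not; T)
open import Data.Nat using (ℕ; zero; suc; _+_; _*_; _∸_; _^_; _≤ᵇ_; _<ᵇ_; _≡ᵇ_; _⊓_; _<?_)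
open import Data.Fin using (Fin; toℕ; _≟_)
open import Data.List using (List; []; _∷_; length; filter; concat; allFin; null; foldr; map; upTo)
open import Data.Bool.ListAction using (all)
open import Data.Nat.ListAction using (sum)
open import Data.Product using (Σ)

-- A partition of {1,…,n} (encoded as Fin n, element i+1 ↔ i) into ordered
-- lists is represented canonically as a list of blocks (each block a list,
-- i.e. a linearly ordered block), the blocks being listed in increasing
-- order of their minimal element.  This canonical ordering makes the
-- representation of an unordered set of blocks unique.

-- minimum (as a natural) of a block; n is a sentinel above every element
minBlock : {n : ℕ} → List (Fin n) → ℕ
minBlock {n} b = foldr (λ x m → toℕ x ⊓ m) n b

sortedByMin : {n : ℕ} → List (List (Fin n)) → Bool
sortedByMin []             = true
sortedByMin (b ∷ [])       = true
sortedByMin (b ∷ c ∷ bs)   = (minBlock b <ᵇ minBlock c) ∧ sortedByMin (c ∷ bs)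

occ : {n : ℕ} → Fin n → List (Fin n) → ℕ
occ i xs = length (filter (_≟ i) xs)

-- number of elements among the first r (the elements 1,…,r) in a block
specials : {n : ℕ} → ℕ → List (Fin n) → ℕ
specials r b = length (filter (λ x → toℕ x <? r) b)

-- validity of a canonical representation of an element counted by L^{(s)}_r(n,k):
--  * every element of {1..n} occurs exactly once among the blocks (set partition),
--  * exactly k blocks,
--  * every block is nonempty and has at least s elements,
--  * elements 1..r lie in pairwise distinct blocks (each block has ≤ 1 of them),
--  * blocks are in canonical order (increasing minima).
validLists : (s r n k : ℕ) → List (List (Fin n)) → Bool
validLists s r n k ls =
  all (λ i → occ i (concat ls) ≡ᵇ 1) (allFin n)
  ∧ (length ls ≡ᵇ k)
  ∧ all (λ b → not (null b) ∧ (s ≤ᵇ length b)) ls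
  ∧ all (λ b → specials r b ≤ᵇ 1) ls
  ∧ sortedByMin ls

LSet : (s r n k : ℕ) → Set
LSet s r n k = Σ (List (List (Fin n))) (λ ls → T (validLists s r n k ls))

sumTo : ℕ → (ℕ → ℕ) → ℕ
sumTo r f = sum (map f (upTo (suc r)))

module Submission where

-- Partitions are counted more generally for an
-- increasing list U of elements of Fin n (Partitions).  In such a partition
-- the block containing the least element u0 of U is u0 inserted at some
-- position into an injective word c over the non-special elements of U
-- other than u0; removing that block leaves a partition of the remaining
-- elements into k - 1 lists (FirstBlock).  Injective words weighted by a
-- function of their length are counted by wordSum (SubWords), so the
-- partitions of U are in bijection with Fin (partitionCount s |U| t k), t the
-- number of special elements of U (partitions↔); for U = allFin n this is
-- LSet s r n k (WholeSet).
--
-- Using the closed form of wordSum through falling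
-- factorials and hockey-stick identities for compositions (comp), induction
-- on k shows partitionCount s n r k · (k - r)! = (n - r)! · Σ_j C(r,j)
-- C(n + j - (s-1)k - 1, k + j - 1) (s-1)^{r-j} (ClosedFormProof).  Dividing
-- by (k - r)! gives mainTheorem7.

open import Defs
open import Data.Bool using (Bool; true; false; _∧_; not; T; if_then_else_)
open import Data.Bool.Properties using (T-irrelevant)
open import Data.Bool.ListAction using (all)
open import Data.Empty using (⊥; ⊥-elim)
open import Data.Fin using (Fin; toℕ; fromℕ<; cast; _≟_)
import Data.Fin as Fin
open import Data.Fin.Properties using (toℕ-fromℕ<; fromℕ<-toℕ; toℕ<n; toℕ-injective; +↔⊎; *↔×; toℕ-cast)
open import Data.List using (List; []; _∷_; [_]; length; filter; concat; _++_; tabulate; allFin; null; map; applyUpTo)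
open import Data.List.Properties using (length-tabulate; length-++; filter-accept; filter-reject; filter-++)
open import Data.Nat using (ℕ; zero; suc; _+_; _*_; _∸_; _^_; _/_; _≤_; _<_; _⊔_; _⊓_; _!; z≤n; s≤s; _≤ᵇ_; _<ᵇ_; _≡ᵇ_; _<?_; NonZero)
open import Data.Nat.Properties hiding (_≟_)
import Data.Nat.Properties as Nat
open import Data.Nat.Combinatorics using (_C_; nCk+nC[k+1]≡[n+1]C[k+1]; nC1≡n; nCn≡1)
open import Data.Nat.Combinatorics.Specification using (k>n⇒nCk≡0)
open import Data.Nat.DivMod using (m*n/n≡m; /-congˡ)
open import Data.Nat.ListAction using (sum)
open import Data.Nat.Tactic.RingSolver using (solve-∀)
open import Data.Product using (Σ; _×_; _,_; proj₁; proj₂; ∃)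
open import Data.Product.Function.Dependent.Propositional using (Σ-↔)
open import Data.Product.Function.NonDependent.Propositional using (_×-↔_)
open import Data.Sum using (_⊎_; inj₁; inj₂)
open import Data.Sum.Function.Propositional using (_⊎-↔_)
open import Data.Unit using (⊤; tt)
open import Function.Base using (_$_)
open import Function.Bundles using (_↔_; mk↔ₛ′)
open import Function.Properties.Inverse using (↔-trans; ↔-sym; ↔-refl)
open import Relation.Nullary using (¬_; Dec; yes; no; does)
open import Relation.Unary using (Pred; Decidable)
open import Relation.Binary.PropositionalEquality hiding ([_])
open ≡-Reasoning

+-exchange : ∀ a b c → a + (b + c) ≡ b + (a + c)
+-exchange = solve-∀

∸≡suc∸suc : ∀ x y → suc y ≤ x → x ∸ y ≡ suc (x ∸ suc y)
∸≡suc∸suc (suc x) zero _ = refl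
∸≡suc∸suc (suc x) (suc y) (s≤s le) = ∸≡suc∸suc x y le

module _ {a p} {A : Set a} {P : Pred A p} (P? : Decidable P) where
  cnt : List A → ℕ
  cnt xs = length (filter P? xs)

  cnt-yes : ∀ {x} xs → P x → cnt (x ∷ xs) ≡ suc (cnt xs)
  cnt-yes xs px = cong length (filter-accept P? {xs = xs} px)

  cnt-no : ∀ {x} xs → ¬ P x → cnt (x ∷ xs) ≡ cnt xs
  cnt-no xs ¬px = cong length (filter-reject P? {xs = xs} ¬px)

  cnt-++ : ∀ xs ys → cnt (xs ++ ys) ≡ cnt xs + cnt ys
  cnt-++ xs ys = trans (cong length (filter-++ P? xs ys)) (length-++ (filter P? xs))

-- Inserting an element at a given position, deleting all copies of an
-- element, and the position of the first copy: the three list operations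
-- which take a block apart and put it back together in the bijection below.
module _ {n : ℕ} where
  occ-head : ∀ (i : Fin n) xs → occ i (i ∷ xs) ≡ suc (occ i xs)
  occ-head i xs = cnt-yes (_≟ i) xs refl

  occ-tail : ∀ {x i : Fin n} xs → x ≢ i → occ i (x ∷ xs) ≡ occ i xs
  occ-tail xs ne = cnt-no (_≟ _) xs ne

  occ-++ : ∀ (i : Fin n) xs ys → occ i (xs ++ ys) ≡ occ i xs + occ i ys
  occ-++ i = cnt-++ (_≟ i)

  insertAt : ℕ → Fin n → List (Fin n) → List (Fin n)
  insertAt zero u c = u ∷ c
  insertAt (suc p) u [] = u ∷ []
  insertAt (suc p) u (x ∷ c) = x ∷ insertAt p u c

  -- delete and position are defined through a helper taking the outcome of
  -- the comparison, so that proofs can case on that outcome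
  delete : Fin n → List (Fin n) → List (Fin n)
  deleteH : (u x : Fin n) → List (Fin n) → Dec (x ≡ u) → List (Fin n)
  delete u [] = []
  delete u (x ∷ b) = deleteH u x b (x ≟ u)
  deleteH u x b (yes _) = delete u b
  deleteH u x b (no _) = x ∷ delete u b

  position : Fin n → List (Fin n) → ℕ
  positionH : (u x : Fin n) → List (Fin n) → Dec (x ≡ u) → ℕ
  position u [] = 0
  position u (x ∷ b) = positionH u x b (x ≟ u)
  positionH u x b (yes _) = 0
  positionH u x b (no _) = suc (position u b)

  cnt-ins : ∀ {p} {P : Pred (Fin n) p} (P? : Decidable P) q u c →
            cnt P? (insertAt q u c) ≡ cnt P? (u ∷ c)
  cnt-ins P? zero u c = refl
  cnt-ins P? (suc q) u [] = refl
  cnt-ins P? (suc q) u (x ∷ c) = begin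
    cnt P? (x ∷ insertAt q u c)              ≡⟨ cnt-++ P? [ x ] (insertAt q u c) ⟩
    cnt P? [ x ] + cnt P? (insertAt q u c)   ≡⟨ cong (cnt P? [ x ] +_) (trans (cnt-ins P? q u c) (cnt-++ P? [ u ] c)) ⟩
    cnt P? [ x ] + (cnt P? [ u ] + cnt P? c) ≡⟨ +-exchange (cnt P? [ x ]) (cnt P? [ u ]) (cnt P? c) ⟩
    cnt P? [ u ] + (cnt P? [ x ] + cnt P? c) ≡⟨ cong (cnt P? [ u ] +_) (sym (cnt-++ P? [ x ] c)) ⟩
    cnt P? [ u ] + cnt P? (x ∷ c)            ≡⟨ sym (cnt-++ P? [ u ] (x ∷ c)) ⟩
    cnt P? (u ∷ x ∷ c)                       ∎

  len-ins : ∀ q u c → length (insertAt q u c) ≡ suc (length c)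
  len-ins zero u c = refl
  len-ins (suc q) u [] = refl
  len-ins (suc q) u (x ∷ c) = cong suc (len-ins q u c)

  occ-cons-≤ : ∀ (w x : Fin n) xs → occ x xs ≤ occ x (w ∷ xs)
  occ-cons-≤ w x xs = go (w ≟ x)
    where go : Dec (w ≡ x) → occ x xs ≤ occ x (w ∷ xs)
          go (yes refl) = subst (occ w xs ≤_) (sym (occ-head w xs)) (n≤1+n _)
          go (no ne) = ≤-reflexive (sym (occ-tail xs ne))

  occ-ne-cons : ∀ (x i : Fin n) b → occ i b ≢ 0 → occ i (x ∷ b) ≢ 0
  occ-ne-cons x i b ne e = ne (n≤0⇒n≡0 (subst (occ i b ≤_) e (occ-cons-≤ x i b)))

  occ-ne-head : ∀ (x : Fin n) b → occ x (x ∷ b) ≢ 0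
  occ-ne-head x b e = 1+n≢0 (trans (sym (occ-head x b)) e)

  occ0-head : ∀ {u : Fin n} x c → occ u (x ∷ c) ≡ 0 → x ≢ u
  occ0-head {u} x c eq refl = 0≢1+n (trans (sym eq) (occ-head u c))

  occ0-tail : ∀ {u : Fin n} x c → occ u (x ∷ c) ≡ 0 → occ u c ≡ 0
  occ0-tail {u} x c eq = trans (sym (occ-tail c (occ0-head x c eq))) eq

  delete-absent : ∀ u c → occ u c ≡ 0 → delete u c ≡ c
  delete-absent u [] _ = refl
  delete-absent u (x ∷ c) eq = go (x ≟ u)
    where go : (d : Dec (x ≡ u)) → deleteH u x c d ≡ x ∷ c
          go (yes x≡u) = ⊥-elim (occ0-head x c eq x≡u)
          go (no _) = cong (x ∷_) (delete-absent u c (occ0-tail x c eq))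

  delete-insert : ∀ q u c → occ u c ≡ 0 → delete u (insertAt q u c) ≡ c
  delete-insert zero u c eq = go (u ≟ u)
    where go : (d : Dec (u ≡ u)) → deleteH u u c d ≡ c
          go (yes _) = delete-absent u c eq
          go (no ne) = ⊥-elim (ne refl)
  delete-insert (suc q) u [] eq = go (u ≟ u)
    where go : (d : Dec (u ≡ u)) → deleteH u u [] d ≡ []
          go (yes _) = refl
          go (no ne) = ⊥-elim (ne refl)
  delete-insert (suc q) u (x ∷ c) eq = go (x ≟ u)
    where go : (d : Dec (x ≡ u)) → deleteH u x (insertAt q u c) d ≡ x ∷ c
          go (yes x≡u) = ⊥-elim (occ0-head x c eq x≡u)
          go (no _) = cong (x ∷_) (delete-insert q u c (occ0-tail x c eq))

  position-insert : ∀ q u c → q ≤ length c → occ u c ≡ 0 → position u (insertAt q u c) ≡ q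
  position-insert zero u c _ eq = go (u ≟ u)
    where go : (d : Dec (u ≡ u)) → positionH u u c d ≡ 0
          go (yes _) = refl
          go (no ne) = ⊥-elim (ne refl)
  position-insert (suc q) u (x ∷ c) (s≤s le) eq = go (x ≟ u)
    where go : (d : Dec (x ≡ u)) → positionH u x (insertAt q u c) d ≡ suc q
          go (yes x≡u) = ⊥-elim (occ0-head x c eq x≡u)
          go (no _) = cong suc (position-insert q u c le (occ0-tail x c eq))

  insert-position-delete : ∀ u b → occ u b ≡ 1 → insertAt (position u b) u (delete u b) ≡ b
  insert-position-delete u [] ()
  insert-position-delete u (x ∷ b) eq = go (x ≟ u)
    where go : (d : Dec (x ≡ u)) → insertAt (positionH u x b d) u (deleteH u x b d) ≡ x ∷ b
          go (yes refl) = cong (u ∷_) (delete-absent u b (suc-injective (trans (sym (occ-head u b)) eq)))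
          go (no ne) = cong (x ∷_) (insert-position-delete u b (trans (sym (occ-tail b ne)) eq))

  position≤length-delete : ∀ u b → position u b ≤ length (delete u b)
  position≤length-delete u [] = z≤n
  position≤length-delete u (x ∷ b) = go (x ≟ u)
    where go : (d : Dec (x ≡ u)) → positionH u x b d ≤ length (deleteH u x b d)
          go (yes _) = z≤n
          go (no _) = s≤s (position≤length-delete u b)

  occ-delete-same : ∀ u b → occ u (delete u b) ≡ 0
  occ-delete-same u [] = refl
  occ-delete-same u (x ∷ b) = go (x ≟ u)
    where go : (d : Dec (x ≡ u)) → occ u (deleteH u x b d) ≡ 0
          go (yes _) = occ-delete-same u b
          go (no ne) = trans (occ-tail (delete u b) ne) (occ-delete-same u b)

  occ-delete-other : ∀ u i b → u ≢ i → occ i (delete u b) ≡ occ i b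
  occ-delete-other u i [] _ = refl
  occ-delete-other u i (x ∷ b) ne = go (x ≟ u)
    where
    ih : occ i (delete u b) ≡ occ i b
    ih = occ-delete-other u i b ne
    go : (d : Dec (x ≡ u)) → occ i (deleteH u x b d) ≡ occ i (x ∷ b)
    go (yes refl) = trans ih (sym (occ-tail b ne))
    go (no _) = go2 (x ≟ i)
      where go2 : Dec (x ≡ i) → occ i (x ∷ delete u b) ≡ occ i (x ∷ b)
            go2 (yes refl) = trans (occ-head x (delete u b)) (trans (cong suc ih) (sym (occ-head x b)))
            go2 (no xi) = trans (occ-tail (delete u b) xi) (trans ih (sym (occ-tail b xi)))

  length-delete : ∀ u b → occ u b ≡ 1 → suc (length (delete u b)) ≡ length b
  length-delete u b eq = trans (sym (len-ins (position u b) u (delete u b))) (cong length (insert-position-delete u b eq))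

Sub : ∀ {a} (A : Set a) → (A → Bool) → Set a
Sub A P = Σ A (λ x → T (P x))

module _ {a} {A : Set a} {P : A → Bool} where
  sub-≡ : {x y : A} {px : T (P x)} {py : T (P y)} → x ≡ y → _≡_ {A = Sub A P} (x , px) (y , py)
  sub-≡ {x} refl = cong (x ,_) (T-irrelevant _ _)

  ΣFin-≡ : {h : A → ℕ} {x y : Sub A P} {f : Fin (h (proj₁ x))} {f' : Fin (h (proj₁ y))} →
           proj₁ x ≡ proj₁ y → toℕ f ≡ toℕ f' → _≡_ {A = Σ (Sub A P) (λ z → Fin (h (proj₁ z)))} (x , f) (y , f')
  ΣFin-≡ {x = x , px} {y = .x , py} {f} {f'} refl e
    rewrite T-irrelevant px py | toℕ-injective e = refl

Σ-cong₂ : ∀ {a b c} {A : Set a} {B : A → Set b} {C : A → Set c} → (∀ x → B x ↔ C x) → Σ A B ↔ Σ A C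
Σ-cong₂ iso = Σ-↔ ↔-refl (λ {x} → iso x)

Fin-+ : ∀ {a b} → (Fin a ⊎ Fin b) ↔ Fin (a + b)
Fin-+ = ↔-sym +↔⊎

Fin-* : ∀ {a b} → (Fin a × Fin b) ↔ Fin (a * b)
Fin-* = ↔-sym *↔×

Fin-cong : ∀ {a b} → a ≡ b → Fin a ↔ Fin b
Fin-cong refl = ↔-refl

empty↔ : ∀ {a} {A : Set a} → (A → ⊥) → A ↔ Fin 0
empty↔ h = mk↔ₛ′ (λ x → ⊥-elim (h x)) (λ ()) (λ ()) (λ x → ⊥-elim (h x))

T∧ : ∀ {b c} → T (b ∧ c) → T b × T c
T∧ {true} {true} _ = tt , tt

T∧→ : ∀ {b c} → T b → T c → T (b ∧ c)
T∧→ {true} {true} _ _ = tt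

Sub×↔ : ∀ {a b} {A : Set a} {B : Set b} (P : A → Bool) (Q : A → B → Bool) →
        Sub (A × B) (λ (x , y) → P x ∧ Q x y) ↔ Σ (Sub A P) (λ x → Sub B (Q (proj₁ x)))
Sub×↔ {A = A} {B} P Q = mk↔ₛ′ split join split∘join join∘split
  where
  split : Sub (A × B) (λ (x , y) → P x ∧ Q x y) → Σ (Sub A P) (λ x → Sub B (Q (proj₁ x)))
  split ((x , y) , pq) = (x , proj₁ (T∧ pq)) , (y , proj₂ (T∧ pq))
  join : Σ (Sub A P) (λ x → Sub B (Q (proj₁ x))) → Sub (A × B) (λ (x , y) → P x ∧ Q x y)
  join ((x , px) , (y , qy)) = (x , y) , T∧→ px qy
  split∘join : ∀ z → split (join z) ≡ z
  split∘join ((x , px) , (y , qy)) = cong₂ (λ p q → (x , p) , (y , q)) (T-irrelevant _ _) (T-irrelevant _ _)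
  join∘split : ∀ z → join (split z) ≡ z
  join∘split ((x , y) , pq) = sub-≡ refl

Fin↔< : ∀ m → Fin m ↔ Sub ℕ (λ j → j <ᵇ m)
Fin↔< m = mk↔ₛ′ (λ i → toℕ i , <⇒<ᵇ (toℕ<n i)) (λ (j , p) → fromℕ< (<ᵇ⇒< j m p))
  (λ (j , p) → sub-≡ (toℕ-fromℕ< _)) (λ i → fromℕ<-toℕ i _)

guardSub : ∀ {a} {X : Set a} (c : Bool) (R : X → Bool) → Sub X (λ x → c ∧ R x) ↔ (T c × Sub X R)
guardSub true R = mk↔ₛ′ (λ (x , t) → tt , (x , t)) (λ (_ , (x , t)) → x , t) (λ _ → refl) (λ _ → refl)
guardSub false R = mk↔ₛ′ (λ ()) (λ ()) (λ ()) (λ ())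

guard↔ : ∀ {a} {X : Set a} {N : ℕ} (c : Bool) → X ↔ Fin N → (T c × X) ↔ Fin (if c then N else 0)
guard↔ true i = ↔-trans (mk↔ₛ′ proj₂ (tt ,_) (λ _ → refl) (λ _ → refl)) i
guard↔ false i = mk↔ₛ′ (λ ()) (λ ()) (λ ()) (λ ())

positionChoice↔ : ∀ {l} {L : Set l} (cond : Bool) (a : ℕ) (Q : L → Bool) {K : ℕ} → Sub L Q ↔ Fin K →
                  Sub (ℕ × L) (λ (p , y) → cond ∧ ((p <ᵇ a) ∧ Q y)) ↔ Fin (if cond then a * K else 0)
positionChoice↔ cond a Q i =
  ↔-trans (guardSub cond (λ (p , y) → (p <ᵇ a) ∧ Q y))
    (guard↔ cond (↔-trans (Sub×↔ (λ p → p <ᵇ a) (λ _ y → Q y))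
      (↔-trans (↔-sym (Fin↔< a) ×-↔ i) Fin-*)))

module _ {a} {A : Set a} (f : A → Bool) where
  allTab→ : ∀ {m} (g : Fin m → A) → T (all f (tabulate g)) → ∀ i → T (f (g i))
  allTab→ {suc m} g t Fin.zero = proj₁ (T∧ {f (g Fin.zero)} t)
  allTab→ {suc m} g t (Fin.suc i) = allTab→ (λ j → g (Fin.suc j)) (proj₂ (T∧ {f (g Fin.zero)} t)) i
  allTab← : ∀ {m} (g : Fin m → A) → (∀ i → T (f (g i))) → T (all f (tabulate g))
  allTab← {zero} g h = tt
  allTab← {suc m} g h = T∧→ (h Fin.zero) (allTab← (λ j → g (Fin.suc j)) (λ i → h (Fin.suc i)))

allF→ : ∀ {n} (f : Fin n → Bool) → T (all f (allFin n)) → ∀ i → T (f i)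
allF→ f = allTab→ f (λ i → i)

allF← : ∀ {n} (f : Fin n → Bool) → (∀ i → T (f i)) → T (all f (allFin n))
allF← f = allTab← f (λ i → i)

-- wordSum w g is the sum of g (length c) over all injective words c whose
-- letters are taken from a fixed set of w letters (subWordCount below); its
-- recursion adds one letter at a time.  The closed form
-- Σ_m w(w-1)⋯(w-m+1) g m is wordSum-closed.
wordSum : ℕ → (ℕ → ℕ) → ℕ
wordSum zero g = g 0
wordSum (suc w) g = wordSum w (λ m → g m + suc m * g (suc m))

-- Words c over a word W: every letter occurs in c at most as often as in W.
-- When W has no repeated letters these are the injective words over W.
module SubWords {n : ℕ} where

  NoDup : List (Fin n) → Set
  NoDup W = ∀ i → occ i W ≤ 1

  isSubWord : List (Fin n) → List (Fin n) → Bool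
  isSubWord W c = all (λ x → occ x c ≤ᵇ occ x W) (allFin n)

  subWord→ : ∀ W c → T (isSubWord W c) → ∀ x → occ x c ≤ occ x W
  subWord→ W c t x = ≤ᵇ⇒≤ _ _ (allF→ (λ x → occ x c ≤ᵇ occ x W) t x)
  subWord← : ∀ W c → (∀ x → occ x c ≤ occ x W) → T (isSubWord W c)
  subWord← W c h = allF← (λ x → occ x c ≤ᵇ occ x W) (λ x → ≤⇒≤ᵇ (h x))

  SubWord : List (Fin n) → Set
  SubWord W = Sub (List (Fin n)) (isSubWord W)

  occ-cons-mono : ∀ (w x : Fin n) c W → occ x c ≤ occ x W → occ x (w ∷ c) ≤ occ x (w ∷ W)
  occ-cons-mono w x c W le = go (w ≟ x)
    where go : Dec (w ≡ x) → occ x (w ∷ c) ≤ occ x (w ∷ W)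
          go (yes refl) = subst₂ _≤_ (sym (occ-head w c)) (sym (occ-head w W)) (s≤s le)
          go (no ne) = subst₂ _≤_ (sym (occ-tail c ne)) (sym (occ-tail W ne)) le

  occ-cons-ne : ∀ {w x : Fin n} xs → x ≢ w → occ x (w ∷ xs) ≡ occ x xs
  occ-cons-ne xs ne = occ-tail xs (λ e → ne (sym e))

  -- A subword of w ∷ W either avoids w, or contains it exactly once; in the
  -- latter case deleting w leaves a subword of W of length one less,
  -- together with the position of w.
  module AddLetter (w : Fin n) (W : List (Fin n)) (nd : NoDup (w ∷ W)) (g : ℕ → ℕ) where
    w∉W : occ w W ≡ 0
    w∉W = n≤0⇒n≡0 (≤-pred (subst (_≤ 1) (occ-head w W) (nd w)))

    ndW : NoDup W
    ndW i = ≤-trans (occ-cons-≤ w i W) (nd i)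

    A B : Set
    A = Σ (SubWord (w ∷ W)) (λ c → Fin (g (length (proj₁ c))))
    B = Σ (SubWord W) (λ c → Fin (g (length (proj₁ c))) ⊎ (Fin (suc (length (proj₁ c))) × Fin (g (suc (length (proj₁ c))))))

    subWord-avoid : ∀ c → T (isSubWord (w ∷ W) c) → occ w c ≡ 0 → T (isSubWord W c)
    subWord-avoid c pc e = subWord← W c λ x → go x (x ≟ w)
      where go : ∀ x → Dec (x ≡ w) → occ x c ≤ occ x W
            go x (yes refl) = subst (_≤ occ x W) (sym e) z≤n
            go x (no ne) = subst (occ x c ≤_) (occ-cons-ne W ne) (subWord→ (w ∷ W) c pc x)

    one : ∀ c → T (isSubWord (w ∷ W) c) → occ w c ≢ 0 → occ w c ≡ 1
    one c pc ne = ≤-antisym (subst (occ w c ≤_) (trans (occ-head w W) (cong suc w∉W)) (subWord→ (w ∷ W) c pc w)) (n≢0⇒n>0 ne)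

    subWord-delete : ∀ c → T (isSubWord (w ∷ W) c) → T (isSubWord W (delete w c))
    subWord-delete c pc = subWord← W (delete w c) λ x → go x (w ≟ x)
      where go : ∀ x → Dec (w ≡ x) → occ x (delete w c) ≤ occ x W
            go x (yes refl) = subst (_≤ occ x W) (sym (occ-delete-same w c)) z≤n
            go x (no ne) = subst₂ _≤_ (sym (occ-delete-other w x c ne)) (occ-tail W ne) (subWord→ (w ∷ W) c pc x)

    subWord-weaken : ∀ c → T (isSubWord W c) → T (isSubWord (w ∷ W) c)
    subWord-weaken c pc = subWord← (w ∷ W) c λ x → ≤-trans (subWord→ W c pc x) (occ-cons-≤ w x W)

    subWord-insert : ∀ q c → T (isSubWord W c) → T (isSubWord (w ∷ W) (insertAt q w c))
    subWord-insert q c pc = subWord← (w ∷ W) (insertAt q w c) λ x → subst (_≤ occ x (w ∷ W)) (sym (cnt-ins (_≟ x) q w c)) (occ-cons-mono w x c W (subWord→ W c pc x))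

    toH : ∀ c → T (isSubWord (w ∷ W) c) → Fin (g (length c)) → Dec (occ w c ≡ 0) → B
    toH c pc f (yes e) = (c , subWord-avoid c pc e) , inj₁ f
    toH c pc f (no ne) = (delete w c , subWord-delete c pc) , inj₂ (fromℕ< (s≤s (position≤length-delete w c)) , cast (cong g (sym (length-delete w c (one c pc ne)))) f)

    to : A → B
    to ((c , pc) , f) = toH c pc f (occ w c Nat.≟ 0)

    from : B → A
    from ((c , pc) , inj₁ f) = (c , subWord-weaken c pc) , f
    from ((c , pc) , inj₂ (p , f)) = (insertAt (toℕ p) w c , subWord-insert (toℕ p) c pc) , cast (cong g (sym (len-ins (toℕ p) w c))) f

    ≡-inj₂ : {c₁ c₂ : SubWord W} {p1 : Fin (suc (length (proj₁ c₁)))} {f1 : Fin (g (suc (length (proj₁ c₁))))}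
           {p2 : Fin (suc (length (proj₁ c₂)))} {f2 : Fin (g (suc (length (proj₁ c₂))))} →
           proj₁ c₁ ≡ proj₁ c₂ → toℕ p1 ≡ toℕ p2 → toℕ f1 ≡ toℕ f2 →
           _≡_ {A = B} (c₁ , inj₂ (p1 , f1)) (c₂ , inj₂ (p2 , f2))
    ≡-inj₂ {x , q1} {.x , q2} refl e1 e2 rewrite T-irrelevant q1 q2 | toℕ-injective e1 | toℕ-injective e2 = refl

    to∘from : ∀ y → to (from y) ≡ y
    to∘from ((c , pc) , inj₁ f) = go (occ w c Nat.≟ 0)
      where
      e0 : occ w c ≡ 0
      e0 = n≤0⇒n≡0 (subst (occ w c ≤_) w∉W (subWord→ W c pc w))
      go : (d : Dec (occ w c ≡ 0)) → toH c (subWord-weaken c pc) f d ≡ ((c , pc) , inj₁ f)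
      go (yes e) = cong (λ z → ((c , z) , inj₁ f)) (T-irrelevant _ _)
      go (no ne) = ⊥-elim (ne e0)
    to∘from ((c , pc) , inj₂ (p , f)) = go (occ w c' Nat.≟ 0)
      where
      c' : List (Fin n)
      c' = insertAt (toℕ p) w c
      f' : Fin (g (length c'))
      f' = cast (cong g (sym (len-ins (toℕ p) w c))) f
      e0 : occ w c ≡ 0
      e0 = n≤0⇒n≡0 (subst (occ w c ≤_) w∉W (subWord→ W c pc w))
      occ1 : occ w c' ≡ suc (occ w c)
      occ1 = trans (cnt-ins (_≟ w) (toℕ p) w c) (occ-head w c)
      go : (d : Dec (occ w c' ≡ 0)) → toH c' (subWord-insert (toℕ p) c pc) f' d ≡ ((c , pc) , inj₂ (p , f))
      go (yes e) = ⊥-elim (1+n≢0 (trans (sym occ1) e))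
      go (no ne) = ≡-inj₂ (delete-insert (toℕ p) w c e0)
        (trans (toℕ-fromℕ< _) (position-insert (toℕ p) w c (≤-pred (toℕ<n p)) e0))
        (trans (toℕ-cast _ f') (toℕ-cast _ f))

    from∘to : ∀ x → from (to x) ≡ x
    from∘to ((c , pc) , f) = go (occ w c Nat.≟ 0)
      where
      go : (d : Dec (occ w c ≡ 0)) → from (toH c pc f d) ≡ ((c , pc) , f)
      go (yes e) = cong (λ z → ((c , z) , f)) (T-irrelevant _ _)
      go (no ne) = ΣFin-≡ {h = λ z → g (length z)}
        (trans (cong (λ q → insertAt q w (delete w c)) (toℕ-fromℕ< _)) (insert-position-delete w c (one c pc ne)))
        (trans (toℕ-cast _ (cast (cong g (sym (length-delete w c (one c pc ne)))) f)) (toℕ-cast _ f))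

    addLetter↔ : A ↔ B
    addLetter↔ = mk↔ₛ′ to from to∘from from∘to

  subWordCount-[] : (g : ℕ → ℕ) → Σ (SubWord []) (λ c → Fin (g (length (proj₁ c)))) ↔ Fin (g 0)
  subWordCount-[] g = mk↔ₛ′ to from (λ _ → refl) from∘to
    where
    absurd : ∀ x c → T (isSubWord [] (x ∷ c)) → ⊥
    absurd x c pc with subst (_≤ 0) (occ-head x c) (subWord→ [] (x ∷ c) pc x)
    ... | ()
    to : Σ (SubWord []) (λ c → Fin (g (length (proj₁ c)))) → Fin (g 0)
    to (([] , _) , f) = f
    to ((x ∷ c , pc) , f) = ⊥-elim (absurd x c pc)
    from : Fin (g 0) → Σ (SubWord []) (λ c → Fin (g (length (proj₁ c))))
    from f = ([] , subWord← [] [] (λ _ → z≤n)) , f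
    from∘to : ∀ x → from (to x) ≡ x
    from∘to (([] , pc) , f) = cong (λ z → (([] , z) , f)) (T-irrelevant _ _)
    from∘to ((x ∷ c , pc) , f) = ⊥-elim (absurd x c pc)

  subWordCount : ∀ W → NoDup W → (g : ℕ → ℕ) → Σ (SubWord W) (λ c → Fin (g (length (proj₁ c)))) ↔ Fin (wordSum (length W) g)
  subWordCount [] nd g = subWordCount-[] g
  subWordCount (w ∷ W) nd g =
    ↔-trans (AddLetter.addLetter↔ w W nd g)
      (↔-trans (Σ-cong₂ (λ c → ↔-trans (↔-refl ⊎-↔ Fin-*) Fin-+))
        (subWordCount W (AddLetter.ndW w W nd g) (λ m → g m + suc m * g (suc m))))

module Sorted {n : ℕ} where
  open SubWords {n}

  keepIf : (Fin n → Bool) → List (Fin n) → List (Fin n)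
  keepIf f [] = []
  keepIf f (x ∷ xs) = if f x then x ∷ keepIf f xs else keepIf f xs

  occ-cases : ∀ (i x : Fin n) xs → occ i (x ∷ xs) ≢ 0 → (x ≡ i) ⊎ (occ i xs ≢ 0)
  occ-cases i x xs ne = go (x ≟ i)
    where go : Dec (x ≡ i) → (x ≡ i) ⊎ (occ i xs ≢ 0)
          go (yes e) = inj₁ e
          go (no ne') = inj₂ (λ e → ne (trans (occ-tail xs ne') e))

  occ-keepIf-kept : ∀ f (i : Fin n) xs → f i ≡ true → occ i (keepIf f xs) ≡ occ i xs
  occ-keepIf-kept f i [] e = refl
  occ-keepIf-kept f i (x ∷ xs) e with f x in fx
  ... | true = go (x ≟ i)
    where go : Dec (x ≡ i) → occ i (x ∷ keepIf f xs) ≡ occ i (x ∷ xs)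
          go (yes refl) = trans (occ-head x (keepIf f xs)) (trans (cong suc (occ-keepIf-kept f i xs e)) (sym (occ-head x xs)))
          go (no ne) = trans (occ-tail (keepIf f xs) ne) (trans (occ-keepIf-kept f i xs e) (sym (occ-tail xs ne)))
  ... | false = go (x ≟ i)
    where go : Dec (x ≡ i) → occ i (keepIf f xs) ≡ occ i (x ∷ xs)
          go (yes refl) with () ← trans (sym fx) e
          go (no ne) = trans (occ-keepIf-kept f i xs e) (sym (occ-tail xs ne))

  occ-keepIf-dropped : ∀ f (i : Fin n) xs → f i ≡ false → occ i (keepIf f xs) ≡ 0
  occ-keepIf-dropped f i [] e = refl
  occ-keepIf-dropped f i (x ∷ xs) e with f x in fx
  ... | true = go (x ≟ i)
    where go : Dec (x ≡ i) → occ i (x ∷ keepIf f xs) ≡ 0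
          go (yes refl) with () ← trans (sym fx) e
          go (no ne) = trans (occ-tail (keepIf f xs) ne) (occ-keepIf-dropped f i xs e)
  ... | false = occ-keepIf-dropped f i xs e

  occ-keepIf-≤ : ∀ f (i : Fin n) xs → occ i (keepIf f xs) ≤ occ i xs
  occ-keepIf-≤ f i xs with f i in fi
  ... | true = ≤-reflexive (occ-keepIf-kept f i xs fi)
  ... | false = subst (_≤ occ i xs) (sym (occ-keepIf-dropped f i xs fi)) z≤n

  Increasing : List (Fin n) → Set
  Increasing [] = ⊤
  Increasing (x ∷ xs) = (∀ y → occ y xs ≢ 0 → toℕ x < toℕ y) × Increasing xs

  increasing-keepIf : ∀ f xs → Increasing xs → Increasing (keepIf f xs)
  increasing-keepIf f [] _ = tt
  increasing-keepIf f (x ∷ xs) (h , st) with f x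
  ... | true = (λ y ne → h y (λ e → ne (n≤0⇒n≡0 (subst (occ y (keepIf f xs) ≤_) e (occ-keepIf-≤ f y xs))))) , increasing-keepIf f xs st
  ... | false = increasing-keepIf f xs st

  increasing-head-fresh : ∀ x xs → Increasing (x ∷ xs) → occ x xs ≡ 0
  increasing-head-fresh x xs (h , _) with occ x xs Nat.≟ 0
  ... | yes e = e
  ... | no ne = ⊥-elim (<-irrefl refl (h x ne))

  increasing⇒noDup : ∀ xs → Increasing xs → NoDup xs
  increasing⇒noDup [] _ i = z≤n
  increasing⇒noDup (x ∷ xs) st i = go (x ≟ i)
    where go : Dec (x ≡ i) → occ i (x ∷ xs) ≤ 1
          go (yes refl) = subst (_≤ 1) (sym (trans (occ-head x xs) (cong suc (increasing-head-fresh x xs st)))) ≤-refl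
          go (no ne) = subst (_≤ 1) (sym (occ-tail xs ne)) (increasing⇒noDup xs (proj₂ st) i)

  module _ {p} {P : Pred (Fin n) p} (P? : Decidable P) where
    occ≤cnt : ∀ {x} xs → P x → occ x xs ≤ cnt P? xs
    occ≤cnt [] px = z≤n
    occ≤cnt {x} (y ∷ xs) px = go (y ≟ x) (P? y)
      where go : Dec (y ≡ x) → Dec (P y) → occ x (y ∷ xs) ≤ cnt P? (y ∷ xs)
            go (yes refl) _ = subst₂ _≤_ (sym (occ-head y xs)) (sym (cnt-yes P? xs px)) (s≤s (occ≤cnt xs px))
            go (no ne) (yes py) = subst₂ _≤_ (sym (occ-tail xs ne)) (sym (cnt-yes P? xs py)) (m≤n⇒m≤1+n (occ≤cnt xs px))
            go (no ne) (no npy) = subst₂ _≤_ (sym (occ-tail xs ne)) (sym (cnt-no P? xs npy)) (occ≤cnt xs px)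

    cnt0 : ∀ xs → (∀ x → occ x xs ≢ 0 → ¬ P x) → cnt P? xs ≡ 0
    cnt0 [] h = refl
    cnt0 (y ∷ xs) h = trans (cnt-no P? xs (h y (occ-ne-head y xs))) (cnt0 xs (λ x ne → h x (λ e → ne (go x e (y ≟ x)))))
      where go : ∀ x → occ x (y ∷ xs) ≡ 0 → Dec (y ≡ x) → occ x xs ≡ 0
            go x e (yes refl) = ⊥-elim (occ-ne-head y xs e)
            go x e (no ne) = trans (sym (occ-tail xs ne)) e

  keepIf-cong : ∀ f f' xs → (∀ y → occ y xs ≢ 0 → f y ≡ f' y) → keepIf f xs ≡ keepIf f' xs
  keepIf-cong f f' [] h = refl
  keepIf-cong f f' (x ∷ xs) h rewrite h x (occ-ne-head x xs) =
    cong (λ z → if f' x then x ∷ z else z) (keepIf-cong f f' xs (λ y ne → h y (λ e → ne (go y e (x ≟ y)))))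
    where go : ∀ y → occ y (x ∷ xs) ≡ 0 → Dec (x ≡ y) → occ y xs ≡ 0
          go y e (yes refl) = ⊥-elim (occ-ne-head x xs e)
          go y e (no ne) = trans (sym (occ-tail xs ne)) e

  removeAll : List (Fin n) → List (Fin n) → List (Fin n)
  removeAll B U = keepIf (λ x → occ x B ≡ᵇ 0) U

  occ-removeAll-kept : ∀ i B U → occ i B ≡ 0 → occ i (removeAll B U) ≡ occ i U
  occ-removeAll-kept i B U e = occ-keepIf-kept (λ x → occ x B ≡ᵇ 0) i U (cong (_≡ᵇ 0) e)

  occ-removeAll-removed : ∀ i B U → occ i B ≢ 0 → occ i (removeAll B U) ≡ 0
  occ-removeAll-removed i B U ne = occ-keepIf-dropped (λ x → occ x B ≡ᵇ 0) i U (go (occ i B) ne)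
    where go : ∀ m → m ≢ 0 → (m ≡ᵇ 0) ≡ false
          go zero ne = ⊥-elim (ne refl)
          go (suc m) _ = refl

  module _ {p} {P : Pred (Fin n) p} (P? : Decidable P) where
    cnt-removeAll : ∀ U → NoDup U → ∀ B → (∀ x → occ x B ≤ occ x U) → cnt P? (removeAll B U) + cnt P? B ≡ cnt P? U
    cnt-removeAll [] nd B sub = cnt0 P? B (λ x ne px → ne (n≤0⇒n≡0 (sub x)))
    cnt-removeAll (x ∷ U) nd B sub with occ x B ≡ᵇ 0 in e
    ... | true = begin
      cnt P? (x ∷ removeAll B U) + cnt P? B                ≡⟨ cong (_+ cnt P? B) (cnt-++ P? [ x ] (removeAll B U)) ⟩
      cnt P? [ x ] + cnt P? (removeAll B U) + cnt P? B     ≡⟨ +-assoc (cnt P? [ x ]) _ _ ⟩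
      cnt P? [ x ] + (cnt P? (removeAll B U) + cnt P? B)   ≡⟨ cong (cnt P? [ x ] +_) (cnt-removeAll U ndU B sub′) ⟩
      cnt P? [ x ] + cnt P? U                              ≡⟨ sym (cnt-++ P? [ x ] U) ⟩
      cnt P? (x ∷ U)                                       ∎
      where
      ndU : NoDup U
      ndU i = ≤-trans (occ-cons-≤ x i U) (nd i)
      x∉B : occ x B ≡ 0
      x∉B = ≡ᵇ⇒≡ _ _ (subst T (sym e) tt)
      sub′ : ∀ y → occ y B ≤ occ y U
      sub′ y with x ≟ y
      ... | yes refl = subst (_≤ occ x U) (sym x∉B) z≤n
      ... | no ne = subst (occ y B ≤_) (occ-tail U ne) (sub y)
    ... | false = begin
      cnt P? (removeAll B U) + cnt P? B                    ≡⟨ cong₂ _+_ (cong (cnt P?) same-removal) B≈x∷B′ ⟩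
      cnt P? (removeAll B′ U) + cnt P? (x ∷ B′)            ≡⟨ cong (cnt P? (removeAll B′ U) +_) (cnt-++ P? [ x ] B′) ⟩
      cnt P? (removeAll B′ U) + (cnt P? [ x ] + cnt P? B′) ≡⟨ +-exchange (cnt P? (removeAll B′ U)) (cnt P? [ x ]) (cnt P? B′) ⟩
      cnt P? [ x ] + (cnt P? (removeAll B′ U) + cnt P? B′) ≡⟨ cong (cnt P? [ x ] +_) (cnt-removeAll U ndU B′ sub′) ⟩
      cnt P? [ x ] + cnt P? U                              ≡⟨ sym (cnt-++ P? [ x ] U) ⟩
      cnt P? (x ∷ U)                                       ∎
      where
      ndU : NoDup U
      ndU i = ≤-trans (occ-cons-≤ x i U) (nd i)
      x∉U : occ x U ≡ 0
      x∉U = n≤0⇒n≡0 (≤-pred (subst (_≤ 1) (occ-head x U) (nd x)))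
      x∈B : occ x B ≢ 0
      x∈B x∉B with () ← trans (sym e) (cong (_≡ᵇ 0) x∉B)
      x-once : occ x B ≡ 1
      x-once = ≤-antisym (subst (occ x B ≤_) (trans (occ-head x U) (cong suc x∉U)) (sub x)) (n≢0⇒n>0 x∈B)
      B′ : List (Fin n)
      B′ = delete x B
      sub′ : ∀ y → occ y B′ ≤ occ y U
      sub′ y with x ≟ y
      ... | yes refl = subst (_≤ occ x U) (sym (occ-delete-same x B)) z≤n
      ... | no ne = subst₂ _≤_ (sym (occ-delete-other x y B ne)) (occ-tail U ne) (sub y)
      -- on U, which avoids x, removing B or B′ is the same
      same-removal : removeAll B U ≡ removeAll B′ U
      same-removal = keepIf-cong _ _ U agree
        where
        agree : ∀ y → occ y U ≢ 0 → (occ y B ≡ᵇ 0) ≡ (occ y B′ ≡ᵇ 0)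
        agree y y∈U with x ≟ y
        ... | yes refl = ⊥-elim (y∈U x∉U)
        ... | no ne = cong (_≡ᵇ 0) (sym (occ-delete-other x y B ne))
      B≈x∷B′ : cnt P? B ≡ cnt P? (x ∷ B′)
      B≈x∷B′ = trans (cong (cnt P?) (sym (insert-position-delete x B x-once))) (cnt-ins P? (position x B) x B′)

    length-keepIf-not : ∀ xs → length (keepIf (λ x → not (does (P? x))) xs) + cnt P? xs ≡ length xs
    length-keepIf-not [] = refl
    length-keepIf-not (x ∷ xs) with P? x
    ... | yes px = trans (+-suc _ _) (cong suc (length-keepIf-not xs))
    ... | no npx = cong suc (length-keepIf-not xs)

  cnt-all : ∀ (xs : List (Fin n)) → cnt {P = λ _ → ⊤} (λ _ → yes tt) xs ≡ length xs
  cnt-all [] = refl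
  cnt-all (x ∷ xs) = cong suc (cnt-all xs)

  minBlock≤ : ∀ (b : List (Fin n)) i → occ i b ≢ 0 → minBlock b ≤ toℕ i
  minBlock≤ [] i ne = ⊥-elim (ne refl)
  minBlock≤ (x ∷ b) i ne with occ-cases i x b ne
  ... | inj₁ refl = m⊓n≤m (toℕ x) (minBlock b)
  ... | inj₂ ne' = ≤-trans (m⊓n≤n (toℕ x) (minBlock b)) (minBlock≤ b i ne')

  <minBlock : ∀ (b : List (Fin n)) a → (∀ i → occ i b ≢ 0 → a < toℕ i) → a < n → a < minBlock b
  <minBlock [] a h an = an
  <minBlock (x ∷ b) a h an = ⊓-glb (h x (occ-ne-head x b)) (<minBlock b a (λ i ne → h i (occ-ne-cons x i b ne)) an)

  sortedByMin-tail : ∀ (b : List (Fin n)) rest → T (sortedByMin (b ∷ rest)) → T (sortedByMin rest)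
  sortedByMin-tail b [] _ = tt
  sortedByMin-tail b (c ∷ cs) t = proj₂ (T∧ {minBlock b <ᵇ minBlock c} t)

  sortedByMin-later : ∀ (b : List (Fin n)) rest i → T (sortedByMin (b ∷ rest)) → occ i (concat rest) ≢ 0 → minBlock b < toℕ i
  sortedByMin-later b [] i t ne = ⊥-elim (ne refl)
  sortedByMin-later b (c ∷ cs) i t ne with occ i c Nat.≟ 0
  ... | no nc = <-≤-trans lt (minBlock≤ c i nc)
    where lt = <ᵇ⇒< _ _ (proj₁ (T∧ {minBlock b <ᵇ minBlock c} t))
  ... | yes zc = <-trans lt (sortedByMin-later c cs i (proj₂ (T∧ {minBlock b <ᵇ minBlock c} t)) (λ e → ne (trans (occ-++ i c (concat cs)) (trans (cong₂ _+_ zc e) refl))))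
    where lt = <ᵇ⇒< _ _ (proj₁ (T∧ {minBlock b <ᵇ minBlock c} t))

  sortedByMin-∷ : ∀ (b : List (Fin n)) rest → T (sortedByMin rest) → (∀ c cs → rest ≡ c ∷ cs → minBlock b < minBlock c) → T (sortedByMin (b ∷ rest))
  sortedByMin-∷ b [] t h = tt
  sortedByMin-∷ b (c ∷ cs) t h = T∧→ (<⇒<ᵇ (h c cs refl)) t

-- partitionCount s v t k counts the partitions of an increasing list of v
-- elements, t of them special, into k ordered lists of length ≥ s with at
-- most one special element each (partitions↔).  The recursion removes the
-- block of the least element: see FirstBlock.
partitionCount : ℕ → ℕ → ℕ → ℕ → ℕ
partitionCount s zero t zero = 1
partitionCount s (suc v) t zero = 0
partitionCount s zero t (suc k) = 0
partitionCount s (suc w) t (suc k) = wordSum (w ∸ (t ∸ 1)) (λ m → if s ≤ᵇ suc m then suc m * partitionCount s (w ∸ m) (t ∸ 1) k else 0)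

-- Partitions of an increasing list U of elements of Fin n, with the side
-- conditions of LSet s r n k: the special elements are those below r.
module Partitions (s r n : ℕ) where
  open SubWords {n}
  open Sorted {n}

  special? : Decidable (λ (x : Fin n) → toℕ x < r)
  special? x = toℕ x <? r

  #special : List (Fin n) → ℕ
  #special = cnt special?

  nonSpecial : List (Fin n) → List (Fin n)
  nonSpecial = keepIf (λ x → not (does (special? x)))

  covers : List (Fin n) → List (List (Fin n)) → Bool
  covers U ls = all (λ i → occ i (concat ls) ≡ᵇ occ i U) (allFin n)
  bigBlock : List (Fin n) → Bool
  bigBlock b = not (null b) ∧ (s ≤ᵇ length b)
  fewSpecial : List (Fin n) → Bool
  fewSpecial b = specials r b ≤ᵇ 1

  isPartition : List (Fin n) → ℕ → List (List (Fin n)) → Bool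
  isPartition U k ls = covers U ls ∧ (length ls ≡ᵇ k) ∧ all bigBlock ls ∧ all fewSpecial ls ∧ sortedByMin ls

  Partition : List (Fin n) → ℕ → Set
  Partition U k = Sub (List (List (Fin n))) (isPartition U k)

  record IsPartition (U : List (Fin n)) (k : ℕ) (ls : List (List (Fin n))) : Set where
    field
      part : ∀ i → occ i (concat ls) ≡ occ i U
      len : length ls ≡ k
      blk : T (all bigBlock ls)
      spc : T (all fewSpecial ls)
      srt : T (sortedByMin ls)

  isPartition→ : ∀ U k ls → T (isPartition U k ls) → IsPartition U k ls
  isPartition→ U k ls t with T∧ {covers U ls} t
  ... | cov , t₁ with T∧ {length ls ≡ᵇ k} t₁
  ... | len , t₂ with T∧ {all bigBlock ls} t₂
  ... | blk , t₃ with T∧ {all fewSpecial ls} t₃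
  ... | spc , srt = record
    { part = λ i → ≡ᵇ⇒≡ _ _ (allF→ (λ i → occ i (concat ls) ≡ᵇ occ i U) cov i)
    ; len = ≡ᵇ⇒≡ _ _ len ; blk = blk ; spc = spc ; srt = srt }

  isPartition← : ∀ U k ls → IsPartition U k ls → T (isPartition U k ls)
  isPartition← U k ls v = T∧→ (allF← (λ i → occ i (concat ls) ≡ᵇ occ i U) (λ i → ≡⇒≡ᵇ _ _ (IsPartition.part v i)))
                (T∧→ (≡⇒≡ᵇ _ _ (IsPartition.len v)) (T∧→ (IsPartition.blk v) (T∧→ (IsPartition.spc v) (IsPartition.srt v))))

  F : ℕ → ℕ → ℕ → ℕ
  F = partitionCount s

  not-null-ins : ∀ p (u : Fin n) c → T (not (null (insertAt p u c)))
  not-null-ins zero u c = tt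
  not-null-ins (suc p) u [] = tt
  not-null-ins (suc p) u (x ∷ c) = tt

  -- The first block of a partition of an increasing list u0 ∷ U₀ is the one
  -- containing the least element u0.  Writing it as u0 inserted at position
  -- p into a word c, the word c can only contain elements of U₀ that are not
  -- special (when u0 is special no other element of the block may be; when
  -- it is not, no element of U₀ is special at all), so c is a subword of
  -- W = nonSpecial U₀.  Conversely c, p and a partition of the leftover
  -- elements into k lists rebuild a partition into k + 1 lists.  The module
  -- takes the count for k lists as induction hypothesis.
  module FirstBlock (u0 : Fin n) (U₀ : List (Fin n)) (srtU : Increasing (u0 ∷ U₀)) (k : ℕ)
                    (partitions↔ᵏ : ∀ U → Increasing U → Partition U k ↔ Fin (F (length U) (#special U) k)) where
    U : List (Fin n)
    U = u0 ∷ U₀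

    notSpecial : Fin n → Bool
    notSpecial x = not (does (special? x))

    W : List (Fin n)
    W = nonSpecial U₀

    t : ℕ
    t = #special U

    w′ : ℕ
    w′ = length U₀

    u0∉U₀ : occ u0 U₀ ≡ 0
    u0∉U₀ = increasing-head-fresh u0 U₀ srtU
    ndU : NoDup U
    ndU = increasing⇒noDup U srtU
    occU0 : occ u0 U ≡ 1
    occU0 = trans (occ-head u0 U₀) (cong suc u0∉U₀)
    gtU : ∀ y → occ y U ≢ 0 → y ≢ u0 → toℕ u0 < toℕ y
    gtU y ne yu = proj₁ srtU y (λ e → ne (trans (occ-tail U₀ (λ e' → yu (sym e'))) e))
    occW≤ : ∀ y → occ y W ≤ occ y U₀
    occW≤ y = occ-keepIf-≤ notSpecial y U₀
    u0∉W : occ u0 W ≡ 0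
    u0∉W = n≤0⇒n≡0 (subst (occ u0 W ≤_) u0∉U₀ (occW≤ u0))
    occW-sp : ∀ x → toℕ x < r → occ x W ≡ 0
    occW-sp x lt = occ-keepIf-dropped notSpecial x U₀ (go (special? x))
      where go : (d : Dec (toℕ x < r)) → not (does d) ≡ false
            go (yes _) = refl
            go (no nl) = ⊥-elim (nl lt)
    occW-ns : ∀ x → ¬ (toℕ x < r) → occ x W ≡ occ x U₀
    occW-ns x nl = occ-keepIf-kept notSpecial x U₀ (go (special? x))
      where go : (d : Dec (toℕ x < r)) → not (does d) ≡ true
            go (yes lt) = ⊥-elim (nl lt)
            go (no _) = refl

    t0 : ¬ (toℕ u0 < r) → t ≡ 0
    t0 nusp = cnt0 special? U (λ y ne ysp → go y ne ysp (y ≟ u0))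
      where go : ∀ y → occ y U ≢ 0 → toℕ y < r → Dec (y ≡ u0) → ⊥
            go y ne ysp (yes refl) = nusp ysp
            go y ne ysp (no yu) = nusp (<-trans (gtU y ne yu) ysp)

    u0∉subWord : ∀ c → T (isSubWord W c) → occ u0 c ≡ 0
    u0∉subWord c pc = n≤0⇒n≡0 (subst (occ u0 c ≤_) u0∉W (subWord→ W c pc u0))

    subWord-nonSpecial : ∀ c → T (isSubWord W c) → #special c ≡ 0
    subWord-nonSpecial c pc = cnt0 special? c (λ x ne xsp → ne (n≤0⇒n≡0 (subst (occ x c ≤_) (occW-sp x xsp) (subWord→ W c pc x))))

    u0∷subWord≤U : ∀ c → T (isSubWord W c) → ∀ i → occ i (u0 ∷ c) ≤ occ i U
    u0∷subWord≤U c pc i = go (u0 ≟ i)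
      where
      go : Dec (u0 ≡ i) → occ i (u0 ∷ c) ≤ occ i U
      go (yes refl) = ≤-reflexive (trans (occ-head u0 c) (trans (cong suc (u0∉subWord c pc)) (sym occU0)))
      go (no ne) = subst₂ _≤_ (sym (occ-tail c ne)) (sym (occ-tail U₀ ne)) (≤-trans (subWord→ W c pc i) (occW≤ i))

    leftover : List (Fin n) → List (Fin n)
    leftover c = removeAll (u0 ∷ c) U

    isDecomposition : List (Fin n) × (ℕ × List (List (Fin n))) → Bool
    isDecomposition (c , (p , rest)) = isSubWord W c ∧ ((s ≤ᵇ suc (length c)) ∧ ((p <ᵇ suc (length c)) ∧ isPartition (leftover c) k rest))

    Decomposition : Set
    Decomposition = Sub (List (Fin n) × (ℕ × List (List (Fin n)))) isDecomposition

    module Split (b : List (Fin n)) (rest : List (List (Fin n))) (v : IsPartition U (suc k) (b ∷ rest)) where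
      part' : ∀ i → occ i b + occ i (concat rest) ≡ occ i U
      part' i = trans (sym (occ-++ i b (concat rest))) (IsPartition.part v i)
      b≤U : ∀ i → occ i b ≤ occ i U
      b≤U i = subst (occ i b ≤_) (part' i) (m≤m+n _ _)
      bigB : T (bigBlock b)
      bigB = proj₁ (T∧ {bigBlock b} (IsPartition.blk v))
      fewB : cnt special? b ≤ 1
      fewB = ≤ᵇ⇒≤ _ _ (proj₁ (T∧ {fewSpecial b} (IsPartition.spc v)))

      -- u0 lies in the first block, since the blocks are sorted by their minima
      u0∈b : occ u0 b ≢ 0
      u0∈b z = <-irrefl refl (<-trans gt lt)
        where
        inRest : occ u0 (concat rest) ≢ 0
        inRest e = 1+n≢0 (trans (sym occU0) (trans (sym (part' u0)) (cong₂ _+_ z e)))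
        lt : minBlock b < toℕ u0
        lt = sortedByMin-later b rest u0 (IsPartition.srt v) inRest
        gt : toℕ u0 < minBlock b
        gt = <minBlock b (toℕ u0) (λ y ne → gtU y (λ e → ne (n≤0⇒n≡0 (subst (occ y b ≤_) e (b≤U y)))) (λ { refl → ne z })) (toℕ<n u0)

      one : occ u0 b ≡ 1
      one = ≤-antisym (subst (occ u0 b ≤_) occU0 (b≤U u0)) (n≢0⇒n>0 u0∈b)

      c : List (Fin n)
      c = delete u0 b

      p : ℕ
      p = position u0 b

      lenb : suc (length c) ≡ length b
      lenb = length-delete u0 b one

      ocb : ∀ i → occ i (u0 ∷ c) ≡ occ i b
      ocb i = trans (sym (cnt-ins (_≟ i) p u0 c)) (cong (occ i) (insert-position-delete u0 b one))

      spb : cnt special? b ≡ cnt special? (u0 ∷ c)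
      spb = trans (cong (cnt special?) (sym (insert-position-delete u0 b one))) (cnt-ins special? p u0 c)

      occ-c : ∀ x → x ≢ u0 → occ x c ≡ occ x b
      occ-c x ne = occ-delete-other u0 x b (λ e → ne (sym e))

      -- the block has at most one special element, and if u0 is not special
      -- neither is anything larger
      c-nonSpecial : ∀ x → toℕ x < r → occ x c ≡ 0
      c-nonSpecial x xsp with special? u0
      ... | yes usp = n≤0⇒n≡0 (≤-trans (occ≤cnt special? c xsp) (≤-pred (subst (_≤ 1) (trans spb (cnt-yes special? c usp)) fewB)))
      ... | no nusp with occ x c Nat.≟ 0
      ...   | yes z = z
      ...   | no nz = ⊥-elim (nusp (<-trans (gtU x x∈U x≢u0) xsp))
        where
        x≢u0 : x ≢ u0
        x≢u0 refl = nz (occ-delete-same u0 b)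
        x∈U : occ x U ≢ 0
        x∈U e = nz (n≤0⇒n≡0 (subst (occ x c ≤_) e (subst (_≤ occ x U) (sym (occ-c x x≢u0)) (b≤U x))))

      c⊆W : ∀ x → occ x c ≤ occ x W
      c⊆W x with x ≟ u0
      ... | yes refl = subst (_≤ occ x W) (sym (occ-delete-same u0 b)) z≤n
      ... | no ne with special? x
      ...   | yes xsp = subst (_≤ occ x W) (sym (c-nonSpecial x xsp)) z≤n
      ...   | no nsp = subst₂ _≤_ (sym (occ-c x ne)) (trans (occ-tail U₀ (λ e → ne (sym e))) (sym (occW-ns x nsp))) (b≤U x)

      c-big : T (s ≤ᵇ suc (length c))
      c-big = subst (λ z → T (s ≤ᵇ z)) (sym lenb) (proj₂ (T∧ {not (null b)} bigB))

      p< : T (p <ᵇ suc (length c))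
      p< = <⇒<ᵇ (s≤s (position≤length-delete u0 b))

      rest-covers : ∀ i → occ i (concat rest) ≡ occ i (leftover c)
      rest-covers i with occ i b Nat.≟ 0
      ... | yes z = trans (trans (sym (cong (_+ occ i (concat rest)) z)) (part' i)) (sym (occ-removeAll-kept i (u0 ∷ c) U (trans (ocb i) z)))
      ... | no nz = trans e0 (sym (occ-removeAll-removed i (u0 ∷ c) U (λ e → nz (trans (sym (ocb i)) e))))
        where
        b1 : occ i b ≡ 1
        b1 = ≤-antisym (≤-trans (b≤U i) (ndU i)) (n≢0⇒n>0 nz)
        u1 : occ i U ≡ 1
        u1 = ≤-antisym (ndU i) (subst (_≤ occ i U) b1 (b≤U i))
        e0 : occ i (concat rest) ≡ 0
        e0 = suc-injective (trans (trans (cong (_+ occ i (concat rest)) (sym b1)) (part' i)) u1)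

      rest-partition : T (isPartition (leftover c) k rest)
      rest-partition = isPartition← (leftover c) k rest (record
        { part = rest-covers ; len = suc-injective (IsPartition.len v)
        ; blk = proj₂ (T∧ {bigBlock b} (IsPartition.blk v)) ; spc = proj₂ (T∧ {fewSpecial b} (IsPartition.spc v))
        ; srt = sortedByMin-tail b rest (IsPartition.srt v) })

      out : Decomposition
      out = (c , (p , rest)) , T∧→ (subWord← W c c⊆W) (T∧→ c-big (T∧→ p< rest-partition))

    module Rebuild (c : List (Fin n)) (p : ℕ) (rest : List (List (Fin n))) (d : T (isDecomposition (c , (p , rest)))) where
      c⊆W : T (isSubWord W c)
      c⊆W = proj₁ (T∧ {isSubWord W c} d)
      big : T (s ≤ᵇ suc (length c))
      big = proj₁ (T∧ {s ≤ᵇ suc (length c)} (proj₂ (T∧ {isSubWord W c} d)))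
      p≤ : p ≤ length c
      p≤ = ≤-pred (<ᵇ⇒< _ _ (proj₁ (T∧ {p <ᵇ suc (length c)} (proj₂ (T∧ {s ≤ᵇ suc (length c)} (proj₂ (T∧ {isSubWord W c} d)))))))
      v' : IsPartition (leftover c) k rest
      v' = isPartition→ (leftover c) k rest (proj₂ (T∧ {p <ᵇ suc (length c)} (proj₂ (T∧ {s ≤ᵇ suc (length c)} (proj₂ (T∧ {isSubWord W c} d))))))

      u0∉c : occ u0 c ≡ 0
      u0∉c = u0∉subWord c c⊆W

      b : List (Fin n)
      b = insertAt p u0 c
      occ-b : ∀ i → occ i b ≡ occ i (u0 ∷ c)
      occ-b i = cnt-ins (_≟ i) p u0 c

      b∷rest-covers : ∀ i → occ i (concat (b ∷ rest)) ≡ occ i U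
      b∷rest-covers i = trans (occ-++ i b (concat rest)) (trans (cong (_+ occ i (concat rest)) (occ-b i)) (trans (cong (occ i (u0 ∷ c) +_) (IsPartition.part v' i)) (go (occ i (u0 ∷ c) Nat.≟ 0))))
        where
        go : Dec (occ i (u0 ∷ c) ≡ 0) → occ i (u0 ∷ c) + occ i (leftover c) ≡ occ i U
        go (yes z) = trans (cong₂ _+_ z (occ-removeAll-kept i (u0 ∷ c) U z)) refl
        go (no nz) = trans (cong (occ i (u0 ∷ c) +_) (occ-removeAll-removed i (u0 ∷ c) U nz))
                     (trans (+-identityʳ _) (≤-antisym (u0∷subWord≤U c c⊆W i) (≤-trans (ndU i) (n≢0⇒n>0 nz))))

      fewB : T (fewSpecial b)
      fewB = ≤⇒≤ᵇ (subst (_≤ 1) (sym (cnt-ins special? p u0 c)) (go (special? u0)))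
        where
        spc0 : cnt special? c ≡ 0
        spc0 = subWord-nonSpecial c c⊆W
        go : Dec (toℕ u0 < r) → cnt special? (u0 ∷ c) ≤ 1
        go (yes usp) = subst (_≤ 1) (sym (trans (cnt-yes special? c usp) (cong suc spc0))) ≤-refl
        go (no nusp) = subst (_≤ 1) (sym (trans (cnt-no special? c nusp) spc0)) z≤n

      bigB : T (bigBlock b)
      bigB = T∧→ (not-null-ins p u0 c) (subst (λ z → T (s ≤ᵇ z)) (sym (len-ins p u0 c)) big)

      -- the minimum of b is u0, which is below everything in the other blocks
      sorted : T (sortedByMin (b ∷ rest))
      sorted = sortedByMin-∷ b rest (IsPartition.srt v') h
        where
        h : ∀ d ds → rest ≡ d ∷ ds → minBlock b < minBlock d
        h d ds refl = ≤-<-trans (minBlock≤ b u0 (λ e → occ-ne-head u0 c (trans (sym (occ-b u0)) e)))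
                        (<minBlock d (toℕ u0) gt (toℕ<n u0))
          where
          gt : ∀ y → occ y d ≢ 0 → toℕ u0 < toℕ y
          gt y ne = gtU y inU yu
            where
            inRest : occ y (concat rest) ≢ 0
            inRest e = ne (n≤0⇒n≡0 (subst (occ y d ≤_) (trans (sym (occ-++ y d (concat ds))) e) (m≤m+n _ _)))
            inU' : occ y (leftover c) ≢ 0
            inU' e = inRest (trans (IsPartition.part v' y) e)
            notb : occ y (u0 ∷ c) ≡ 0
            notb with occ y (u0 ∷ c) Nat.≟ 0
            ... | yes z = z
            ... | no nz = ⊥-elim (inU' (occ-removeAll-removed y (u0 ∷ c) U nz))
            inU : occ y U ≢ 0
            inU e = inU' (n≤0⇒n≡0 (subst (occ y (leftover c) ≤_) e (occ-keepIf-≤ (λ x → occ x (u0 ∷ c) ≡ᵇ 0) y U)))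
            yu : y ≢ u0
            yu refl = occ-ne-head u0 c notb

      out : Partition U (suc k)
      out = (b ∷ rest) , isPartition← U (suc k) (b ∷ rest) (record
        { part = b∷rest-covers ; len = cong suc (IsPartition.len v')
        ; blk = T∧→ bigB (IsPartition.blk v') ; spc = T∧→ fewB (IsPartition.spc v') ; srt = sorted })

    absurdNil : T (isPartition U (suc k) []) → ⊥
    absurdNil t with () ← IsPartition.len (isPartition→ U (suc k) [] t)

    split↔ : Partition U (suc k) ↔ Decomposition
    split↔ = mk↔ₛ′ to from to∘from from∘to
      where
      to : Partition U (suc k) → Decomposition
      to ([] , t) = ⊥-elim (absurdNil t)
      to (b ∷ rest , t) = Split.out b rest (isPartition→ U (suc k) (b ∷ rest) t)
      from : Decomposition → Partition U (suc k)
      from ((c , (p , rest)) , d) = Rebuild.out c p rest d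
      to∘from : ∀ y → to (from y) ≡ y
      to∘from ((c , (p , rest)) , d) = sub-≡ (cong₂ _,_ (delete-insert p u0 c (Rebuild.u0∉c c p rest d))
                                        (cong (_, rest) (position-insert p u0 c (Rebuild.p≤ c p rest d) (Rebuild.u0∉c c p rest d))))
      from∘to : ∀ x → from (to x) ≡ x
      from∘to ([] , t) = ⊥-elim (absurdNil t)
      from∘to (b ∷ rest , t) = sub-≡ (cong (_∷ rest) (insert-position-delete u0 b (Split.one b rest (isPartition→ U (suc k) (b ∷ rest) t))))

    lenEq : ∀ c → T (isSubWord W c) → length (leftover c) ≡ w′ ∸ length c
    lenEq c pc = sym (trans (cong (_∸ length c) (sym e2)) (m+n∸n≡m (length (leftover c)) (length c)))
      where
      e1 : cnt {P = λ _ → ⊤} (λ _ → yes tt) (leftover c) + cnt {P = λ _ → ⊤} (λ _ → yes tt) (u0 ∷ c) ≡ cnt {P = λ _ → ⊤} (λ _ → yes tt) U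
      e1 = cnt-removeAll (λ _ → yes tt) U ndU (u0 ∷ c) (u0∷subWord≤U c pc)
      e2 : length (leftover c) + length c ≡ w′
      e2 = suc-injective (trans (sym (+-suc _ _)) (trans (cong₂ _+_ (sym (cnt-all (leftover c))) (sym (cnt-all (u0 ∷ c)))) (trans e1 (cnt-all U))))

    specEq : ∀ c → T (isSubWord W c) → #special (leftover c) ≡ t ∸ 1
    specEq c pc = go (special? u0)
      where
      e1 : #special (leftover c) + #special (u0 ∷ c) ≡ t
      e1 = cnt-removeAll special? U ndU (u0 ∷ c) (u0∷subWord≤U c pc)
      spc0 : #special c ≡ 0
      spc0 = subWord-nonSpecial c pc
      go : Dec (toℕ u0 < r) → #special (leftover c) ≡ t ∸ 1
      go (yes usp) = sym (trans (cong (_∸ 1) (sym e1)) (trans (cong (λ z → #special (leftover c) + z ∸ 1) (trans (cnt-yes special? c usp) (cong suc spc0))) (m+n∸n≡m _ 1)))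
      go (no nusp) = trans (trans (sym (+-identityʳ _)) (trans (cong (#special (leftover c) +_) (sym (trans (cnt-no special? c nusp) spc0))) e1)) (trans (t0 nusp) (sym (cong (_∸ 1) (t0 nusp))))

    -- W has w′ - (t - 1) letters: the elements of U₀ minus its special ones
    lenW : length W ≡ w′ ∸ (t ∸ 1)
    lenW = sym (trans (cong (_∸ (t ∸ 1)) (sym e1)) (trans (cong (length W + #special U₀ ∸_) (sym sU₀)) (m+n∸n≡m (length W) (#special U₀))))
      where
      e1 : length W + #special U₀ ≡ w′
      e1 = length-keepIf-not special? U₀
      sU₀ : #special U₀ ≡ t ∸ 1
      sU₀ with special? u0
      ... | yes usp = sym (cong (_∸ 1) (cnt-yes special? U₀ usp))
      ... | no nusp = trans (sym (cnt-no special? U₀ nusp)) (trans (t0 nusp) (sym (cong (_∸ 1) (t0 nusp))))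

    -- weight of a subword of length m: the number of ways to place u0 in it
    -- times the number of partitions of the leftover
    weightOf : ℕ → ℕ
    weightOf m = if s ≤ᵇ suc m then suc m * F (w′ ∸ m) (t ∸ 1) k else 0

    afterWord : List (Fin n) → ℕ × List (List (Fin n)) → Bool
    afterWord c (p , rest) = (s ≤ᵇ suc (length c)) ∧ ((p <ᵇ suc (length c)) ∧ isPartition (leftover c) k rest)

    afterWord↔ : (cc : SubWord W) → Sub (ℕ × List (List (Fin n))) (afterWord (proj₁ cc)) ↔ Fin (weightOf (length (proj₁ cc)))
    afterWord↔ (c , pc) = positionChoice↔ (s ≤ᵇ suc (length c)) (suc (length c)) (isPartition (leftover c) k)
      (↔-trans (partitions↔ᵏ (leftover c) (increasing-keepIf (λ x → occ x (u0 ∷ c) ≡ᵇ 0) U srtU))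
               (Fin-cong (cong₂ (λ a b → F a b k) (lenEq c pc) (specEq c pc))))

    count : Partition U (suc k) ↔ Fin (F (length U) t (suc k))
    count =
      ↔-trans split↔
      (↔-trans (Sub×↔ (isSubWord W) afterWord)
      (↔-trans (Σ-cong₂ afterWord↔)
      (↔-trans (subWordCount W (increasing⇒noDup W (increasing-keepIf notSpecial U₀ (proj₂ srtU))) weightOf)
               (Fin-cong (cong (λ z → wordSum z weightOf) lenW)))))

  partitions↔ : ∀ k U → Increasing U → Partition U k ↔ Fin (F (length U) (#special U) k)
  partitions↔ zero [] _ = mk↔ₛ′ (λ _ → Fin.zero) (λ _ → emptyPartition) (λ { Fin.zero → refl ; (Fin.suc ()) }) unique
    where
    emptyPartition : Partition [] 0
    emptyPartition = [] , isPartition← [] 0 [] (record { part = λ i → refl ; len = refl ; blk = tt ; spc = tt ; srt = tt })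
    unique : ∀ x → emptyPartition ≡ x
    unique ([] , t) = sub-≡ refl
    unique (b ∷ rest , t) with () ← IsPartition.len (isPartition→ [] 0 (b ∷ rest) t)
  partitions↔ zero (u ∷ U) _ = empty↔ none
    where
    none : Partition (u ∷ U) 0 → ⊥
    none ([] , t) = 1+n≢0 (sym (trans (IsPartition.part (isPartition→ (u ∷ U) 0 [] t) u) (occ-head u U)))
    none (b ∷ rest , t) with () ← IsPartition.len (isPartition→ (u ∷ U) 0 (b ∷ rest) t)
  partitions↔ (suc k) [] _ = empty↔ none
    where
    none : Partition [] (suc k) → ⊥
    none ([] , t) with () ← IsPartition.len (isPartition→ [] (suc k) [] t)
    none ([] ∷ rest , t) = proj₁ (T∧ {bigBlock []} {all bigBlock rest} (IsPartition.blk (isPartition→ [] (suc k) ([] ∷ rest) t)))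
    none ((y ∷ b) ∷ rest , t) = occ-ne-head y (b ++ concat rest) (IsPartition.part (isPartition→ [] (suc k) ((y ∷ b) ∷ rest) t) y)
  partitions↔ (suc k) (u0 ∷ U₀) srtU = FirstBlock.count u0 U₀ srtU k (partitions↔ k)

module _ {n : ℕ} where
  open Sorted {n}

  tab-mem : ∀ {m} (g : Fin m → Fin n) y → occ y (tabulate g) ≢ 0 → ∃ λ j → g j ≡ y
  tab-mem {zero} g y ne = ⊥-elim (ne refl)
  tab-mem {suc m} g y ne with occ-cases y (g Fin.zero) (tabulate (λ j → g (Fin.suc j))) ne
  ... | inj₁ e = Fin.zero , e
  ... | inj₂ ne' with tab-mem (λ j → g (Fin.suc j)) y ne'
  ...   | j , e = Fin.suc j , e

  tab-has : ∀ {m} (g : Fin m → Fin n) j → occ (g j) (tabulate g) ≢ 0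
  tab-has g Fin.zero = occ-ne-head (g Fin.zero) _
  tab-has g (Fin.suc j) = occ-ne-cons (g Fin.zero) (g (Fin.suc j)) _ (tab-has (λ i → g (Fin.suc i)) j)

  tab-srt : ∀ {m} a (g : Fin m → Fin n) → (∀ j → toℕ (g j) ≡ a + toℕ j) → Increasing (tabulate g)
  tab-srt {zero} a g h = tt
  tab-srt {suc m} a g h = gt , tab-srt (suc a) (λ j → g (Fin.suc j)) (λ j → trans (h (Fin.suc j)) (+-suc a (toℕ j)))
    where
    gt : ∀ y → occ y (tabulate (λ j → g (Fin.suc j))) ≢ 0 → toℕ (g Fin.zero) < toℕ y
    gt y ne with tab-mem (λ j → g (Fin.suc j)) y ne
    ... | j , refl = subst₂ _<_ (sym (trans (h Fin.zero) (+-identityʳ a))) (sym (h (Fin.suc j))) (m<m+n a (s≤s z≤n))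

  tab-spec : ∀ {m} r a (g : Fin m → Fin n) → (∀ j → toℕ (g j) ≡ a + toℕ j) → cnt (λ x → toℕ x <? r) (tabulate g) ≡ (r ∸ a) ⊓ m
  tab-spec {zero} r a g h = sym (⊓-zeroʳ (r ∸ a))
  tab-spec {suc m} r a g h with toℕ (g Fin.zero) <? r
  ... | yes lt = trans (cnt-yes (λ x → toℕ x <? r) (tabulate (λ j → g (Fin.suc j))) lt) $ trans (cong suc (tab-spec r (suc a) (λ j → g (Fin.suc j)) (λ j → trans (h (Fin.suc j)) (+-suc a (toℕ j)))))
                   (cong (_⊓ suc m) (sym (∸≡suc∸suc r a lt')))
    where
    lt' : suc a ≤ r
    lt' = subst (_< r) (trans (h Fin.zero) (+-identityʳ a)) lt
  ... | no nlt = trans (cnt-no (λ x → toℕ x <? r) (tabulate (λ j → g (Fin.suc j))) nlt) $ trans (tab-spec r (suc a) (λ j → g (Fin.suc j)) (λ j → trans (h (Fin.suc j)) (+-suc a (toℕ j))))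
                   (trans (cong (_⊓ m) (m≤n⇒m∸n≡0 (≤-trans (≮⇒≥ nlt') (n≤1+n a)))) (cong (_⊓ suc m) (sym (m≤n⇒m∸n≡0 (≮⇒≥ nlt')))))
    where nlt' : ¬ (a < r)
          nlt' l = nlt (subst (_< r) (sym (trans (h Fin.zero) (+-identityʳ a))) l)

module WholeSet (s r n : ℕ) (r≤n : r ≤ n) where
  open Sorted {n}
  open Partitions s r n

  srtAll : Increasing (allFin n)
  srtAll = tab-srt 0 (λ j → j) (λ j → refl)

  occAll : ∀ i → occ i (allFin n) ≡ 1
  occAll i = ≤-antisym (increasing⇒noDup (allFin n) srtAll i) (n≢0⇒n>0 (tab-has (λ j → j) i))

  lenAll : length (allFin n) ≡ n
  lenAll = length-tabulate (λ j → j)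

  specAll : #special (allFin n) ≡ r
  specAll = trans (tab-spec r 0 (λ j → j) (λ j → refl)) (m≤n⇒m⊓n≡m r≤n)

  -- LSet only differs from the partitions of allFin n in how the covering
  -- condition is phrased: every element occurs once
  module _ (k : ℕ) where
    rest : List (List (Fin n)) → Bool
    rest ls = (length ls ≡ᵇ k) ∧ all bigBlock ls ∧ all fewSpecial ls ∧ sortedByMin ls

    valid→partition : ∀ ls → T (validLists s r n k ls) → T (isPartition (allFin n) k ls)
    valid→partition ls t = T∧→ (allF← _ (λ i → subst (λ z → T (occ i (concat ls) ≡ᵇ z)) (sym (occAll i)) (allF→ (λ i → occ i (concat ls) ≡ᵇ 1) (proj₁ sp) i))) (proj₂ sp)
      where
      sp : T (all (λ i → occ i (concat ls) ≡ᵇ 1) (allFin n)) × T (rest ls)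
      sp = T∧ {all (λ i → occ i (concat ls) ≡ᵇ 1) (allFin n)} {rest ls} t

    partition→valid : ∀ ls → T (isPartition (allFin n) k ls) → T (validLists s r n k ls)
    partition→valid ls t = T∧→ (allF← _ (λ i → subst (λ z → T (occ i (concat ls) ≡ᵇ z)) (occAll i) (allF→ (λ i → occ i (concat ls) ≡ᵇ occ i (allFin n)) (proj₁ sp) i))) (proj₂ sp)
      where
      sp : T (covers (allFin n) ls) × T (rest ls)
      sp = T∧ {covers (allFin n) ls} {rest ls} t

    LSet↔Partition : LSet s r n k ↔ Partition (allFin n) k
    LSet↔Partition = mk↔ₛ′ (λ (ls , t) → ls , valid→partition ls t) (λ (ls , t) → ls , partition→valid ls t) (λ _ → sub-≡ refl) (λ _ → sub-≡ refl)

    LSet↔partitionCount : LSet s r n k ↔ Fin (F n r k)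
    LSet↔partitionCount = ↔-trans LSet↔Partition (↔-trans (partitions↔ k (allFin n) srtAll) (Fin-cong (cong₂ (λ a b → F a b k) lenAll specAll)))

Σ< : ℕ → (ℕ → ℕ) → ℕ
Σ< zero f = 0
Σ< (suc m) f = f 0 + Σ< m (λ i → f (suc i))

Σ<-cong : ∀ m {f g} → (∀ i → i < m → f i ≡ g i) → Σ< m f ≡ Σ< m g
Σ<-cong zero h = refl
Σ<-cong (suc m) h = cong₂ _+_ (h 0 (s≤s z≤n)) (Σ<-cong m (λ i lt → h (suc i) (s≤s lt)))

Σ<-+ : ∀ m f g → Σ< m (λ i → f i + g i) ≡ Σ< m f + Σ< m g
Σ<-+ zero f g = refl
Σ<-+ (suc m) f g = trans (cong (f 0 + g 0 +_) (Σ<-+ m _ _)) (+-+-exchange (f 0) (g 0) _ _)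
  where +-+-exchange : ∀ a b x y → a + b + (x + y) ≡ a + x + (b + y)
        +-+-exchange = solve-∀

Σ<-* : ∀ m a f → a * Σ< m f ≡ Σ< m (λ i → a * f i)
Σ<-* zero a f = *-zeroʳ a
Σ<-* (suc m) a f = trans (*-distribˡ-+ a (f 0) _) (cong (a * f 0 +_) (Σ<-* m a _))

Σ<-last : ∀ m f → Σ< (suc m) f ≡ Σ< m f + f m
Σ<-last zero f = +-comm (f 0) 0
Σ<-last (suc m) f = trans (cong (f 0 +_) (Σ<-last m (λ i → f (suc i)))) (sym (+-assoc (f 0) _ _))

Σ<-0 : ∀ m f → (∀ i → i < m → f i ≡ 0) → Σ< m f ≡ 0
Σ<-0 m f h = trans (Σ<-cong m h) (z m)
  where z : ∀ m → Σ< m (λ _ → 0) ≡ 0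
        z zero = refl
        z (suc m) = z m

Σ<-ext : ∀ m d f → (∀ i → m ≤ i → i < m + d → f i ≡ 0) → Σ< (m + d) f ≡ Σ< m f
Σ<-ext zero d f h = Σ<-0 d f (λ i lt → h i z≤n lt)
Σ<-ext (suc m) d f h = cong (f 0 +_) (Σ<-ext m d (λ i → f (suc i)) (λ i le lt → h (suc i) (s≤s le) (s≤s lt)))

Σ<-ext' : ∀ m m' f → m ≤ m' → (∀ i → m ≤ i → i < m' → f i ≡ 0) → Σ< m' f ≡ Σ< m f
Σ<-ext' m m' f le h = trans (cong (λ z → Σ< z f) (sym e)) (Σ<-ext m (m' ∸ m) f (λ i l1 l2 → h i l1 (subst (i <_) e l2)))
  where e = m+[n∸m]≡n le

Σ<-shift : ∀ c m f → (∀ i → i < c → f i ≡ 0) → Σ< (c + m) f ≡ Σ< m (λ i → f (c + i))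
Σ<-shift zero m f h = refl
Σ<-shift (suc c) m f h = trans (cong (_+ Σ< (c + m) (λ i → f (suc i))) (h 0 (s≤s z≤n))) (Σ<-shift c m (λ i → f (suc i)) (λ i lt → h (suc i) (s≤s lt)))

Σ<-swap : ∀ a b (f : ℕ → ℕ → ℕ) → Σ< a (λ i → Σ< b (λ j → f i j)) ≡ Σ< b (λ j → Σ< a (λ i → f i j))
Σ<-swap zero b f = sym (Σ<-0 b _ (λ _ _ → refl))
Σ<-swap (suc a) b f = trans (cong (Σ< b (λ j → f 0 j) +_) (Σ<-swap a b (λ i j → f (suc i) j))) (sym (Σ<-+ b (λ j → f 0 j) _))

-- comp x K = C(x-1, K-1) is the number of compositions of x into K
-- positive parts (with comp 0 0 = 1).
comp : ℕ → ℕ → ℕ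
comp zero zero = 1
comp (suc x) zero = 0
comp zero (suc K) = 0
comp (suc x) (suc K) = x C K

comp-pascal : ∀ x K → comp (suc x) (suc K) ≡ comp x K + comp x (suc K)
comp-pascal zero zero = refl
comp-pascal zero (suc K) = k>n⇒nCk≡0 {0} {suc K} (s≤s z≤n)
comp-pascal (suc x) zero = refl
comp-pascal (suc x) (suc K) = sym (nCk+nC[k+1]≡[n+1]C[k+1] x K)

comp-0 : ∀ x K → x < K → comp x K ≡ 0
comp-0 zero (suc K) _ = refl
comp-0 (suc x) (suc K) (s≤s lt) = k>n⇒nCk≡0 lt

-- hockey-stick identities: summing over the size of the last part
comp-sum : ∀ X K → Σ< (suc X) (λ b → comp (X ∸ b) K) ≡ comp (suc X) (suc K)
comp-sum zero K = trans (+-identityʳ _) (trans (sym (+-identityʳ _)) (sym (comp-pascal 0 K)))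
comp-sum (suc X) K = trans (cong (comp (suc X) K +_) (comp-sum X K)) (sym (comp-pascal (suc X) K))

comp-weighted-sum : ∀ X K → Σ< (suc X) (λ b → suc b * comp (X ∸ b) K) ≡ comp (suc (suc X)) (suc (suc K))
comp-weighted-sum zero K = begin
  1 * comp 0 K + 0 ≡⟨ trans (+-identityʳ (1 * comp 0 K)) (*-identityˡ (comp 0 K)) ⟩
  comp 0 K ≡⟨ sym (+-identityʳ (comp 0 K)) ⟩
  comp 0 K + comp 0 (suc K) ≡⟨ sym (comp-pascal 0 K) ⟩
  comp 1 (suc K) ≡⟨ sym (+-identityʳ (comp 1 (suc K))) ⟩
  comp 1 (suc K) + comp 0 (suc (suc K)) ≡⟨ cong (comp 1 (suc K) +_) (sym (+-identityʳ (comp 0 (suc K)))) ⟩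
  comp 1 (suc K) + (comp 0 (suc K) + comp 0 (suc (suc K))) ≡⟨ cong (comp 1 (suc K) +_) (sym (comp-pascal 0 (suc K))) ⟩
  comp 1 (suc K) + comp 1 (suc (suc K)) ≡⟨ sym (comp-pascal 1 (suc K)) ⟩
  comp 2 (suc (suc K)) ∎
comp-weighted-sum (suc X) K = begin
  1 * comp (suc X) K + Σ< (suc X) (λ b → suc (suc b) * comp (X ∸ b) K)
    ≡⟨ cong₂ _+_ (*-identityˡ (comp (suc X) K)) (Σ<-+ (suc X) (λ b → comp (X ∸ b) K) (λ b → suc b * comp (X ∸ b) K)) ⟩
  comp (suc X) K + (Σ< (suc X) (λ b → comp (X ∸ b) K) + Σ< (suc X) (λ b → suc b * comp (X ∸ b) K))
    ≡⟨ cong (comp (suc X) K +_) (cong₂ _+_ (comp-sum X K) (comp-weighted-sum X K)) ⟩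
  comp (suc X) K + (comp (suc X) (suc K) + comp (suc (suc X)) (suc (suc K)))
    ≡⟨ sym (+-assoc (comp (suc X) K) (comp (suc X) (suc K)) (comp (suc (suc X)) (suc (suc K)))) ⟩
  comp (suc X) K + comp (suc X) (suc K) + comp (suc (suc X)) (suc (suc K))
    ≡⟨ cong (_+ comp (suc (suc X)) (suc (suc K))) (sym (comp-pascal (suc X) K)) ⟩
  comp (suc (suc X)) (suc K) + comp (suc (suc X)) (suc (suc K))
    ≡⟨ sym (comp-pascal (suc (suc X)) (suc K)) ⟩
  comp (suc (suc (suc X))) (suc (suc K)) ∎

absorption : ∀ n k → suc k * (suc n C suc k) ≡ suc n * (n C k)
absorption zero zero = refl
absorption zero (suc k) = trans (cong (suc (suc k) *_) (k>n⇒nCk≡0 {1} {suc (suc k)} (s≤s (s≤s z≤n)))) (trans (*-zeroʳ (suc (suc k))) (sym (cong (1 *_) (k>n⇒nCk≡0 {0} {suc k} (s≤s z≤n)))))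
absorption (suc n) zero = trans (+-identityʳ _) (trans (nC1≡n (suc (suc n))) (sym (*-identityʳ _)))
absorption (suc n) (suc k) = begin
  suc (suc k) * (suc (suc n) C suc (suc k))
    ≡⟨ cong (suc (suc k) *_) (sym (nCk+nC[k+1]≡[n+1]C[k+1] (suc n) (suc k))) ⟩
  suc (suc k) * (suc n C suc k + suc n C suc (suc k))
    ≡⟨ *-distribˡ-+ (suc (suc k)) (suc n C suc k) (suc n C suc (suc k)) ⟩
  suc (suc k) * (suc n C suc k) + suc (suc k) * (suc n C suc (suc k))
    ≡⟨ cong (suc (suc k) * (suc n C suc k) +_) (absorption n (suc k)) ⟩
  (suc n C suc k + suc k * (suc n C suc k)) + suc n * (n C suc k)
    ≡⟨ cong (λ z → (suc n C suc k + z) + suc n * (n C suc k)) (absorption n k) ⟩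
  (suc n C suc k + suc n * (n C k)) + suc n * (n C suc k)
    ≡⟨ +-assoc (suc n C suc k) (suc n * (n C k)) (suc n * (n C suc k)) ⟩
  suc n C suc k + (suc n * (n C k) + suc n * (n C suc k))
    ≡⟨ cong (suc n C suc k +_) (sym (*-distribˡ-+ (suc n) (n C k) (n C suc k))) ⟩
  suc n C suc k + suc n * (n C k + n C suc k)
    ≡⟨ cong (λ z → suc n C suc k + suc n * z) (nCk+nC[k+1]≡[n+1]C[k+1] n k) ⟩
  suc n C suc k + suc n * (suc n C suc k)
    ≡⟨⟩
  suc (suc n) * (suc n C suc k) ∎

-- falling w m = w (w - 1) ⋯ (w - m + 1), the number of injective words of
-- length m over w letters
falling : ℕ → ℕ → ℕ
falling w zero = 1
falling zero (suc m) = 0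
falling (suc w) (suc m) = suc w * falling w m

falling-0 : ∀ w m → w < m → falling w m ≡ 0
falling-0 zero (suc m) _ = refl
falling-0 (suc w) (suc m) (s≤s lt) = trans (cong (suc w *_) (falling-0 w m lt)) (*-zeroʳ (suc w))

falling-suc : ∀ w m → falling (suc w) (suc m) ≡ falling w (suc m) + suc m * falling w m
falling-suc zero zero = refl
falling-suc zero (suc m) = trans (*-zeroʳ 1) (sym (*-zeroʳ (suc (suc m))))
falling-suc (suc w) zero = trans (*-identityʳ (suc (suc w))) (trans (+-comm 1 (suc w)) (cong₂ _+_ (sym (*-identityʳ (suc w))) refl))
falling-suc (suc w) (suc m) = sym (begin
  suc w * falling w (suc m) + suc (suc m) * (suc w * falling w m) ≡⟨ regroup (suc w) (falling w (suc m)) (suc m) (falling w m) ⟩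
  suc w * (falling w (suc m) + suc m * falling w m) + suc w * falling w m ≡⟨ cong (λ z → suc w * z + suc w * falling w m) (sym (falling-suc w m)) ⟩
  suc w * (suc w * falling w m) + suc w * falling w m ≡⟨ collect (suc w) (falling w m) ⟩
  suc (suc w) * (suc w * falling w m) ∎)
  where
  regroup : ∀ W b M a → W * b + suc M * (W * a) ≡ W * (b + M * a) + W * a
  regroup = solve-∀
  collect : ∀ W a → W * (W * a) + W * a ≡ suc W * (W * a)
  collect = solve-∀

falling-factorial : ∀ w m → m ≤ w → falling w m * (w ∸ m) ! ≡ w !
falling-factorial w zero _ = *-identityˡ (w !)
falling-factorial (suc w) (suc m) (s≤s le) = trans (*-assoc (suc w) (falling w m) ((w ∸ m) !)) (cong (suc w *_) (falling-factorial w m le))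

wordSum-cong : ∀ w g h → (∀ m → g m ≡ h m) → wordSum w g ≡ wordSum w h
wordSum-cong zero g h e = e 0
wordSum-cong (suc w) g h e = wordSum-cong w _ _ (λ m → cong₂ _+_ (e m) (cong (suc m *_) (e (suc m))))

wordSum-closed : ∀ w g → wordSum w g ≡ Σ< (suc w) (λ m → falling w m * g m)
wordSum-closed zero g = sym (trans (+-identityʳ _) (*-identityˡ (g 0)))
wordSum-closed (suc w) g = begin
  wordSum w (λ m → g m + suc m * g (suc m))
    ≡⟨ wordSum-closed w _ ⟩
  Σ< (suc w) (λ m → falling w m * (g m + suc m * g (suc m)))
    ≡⟨ Σ<-cong (suc w) (λ m _ → *-distribˡ-+ (falling w m) (g m) (suc m * g (suc m))) ⟩
  Σ< (suc w) (λ m → falling w m * g m + falling w m * (suc m * g (suc m)))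
    ≡⟨ Σ<-+ (suc w) (λ m → falling w m * g m) (λ m → falling w m * (suc m * g (suc m))) ⟩
  Σ< (suc w) (λ m → falling w m * g m) + Σ< (suc w) (λ m → falling w m * (suc m * g (suc m)))
    ≡⟨ cong₂ _+_ (cong (_+ A) (*-identityˡ (g 0))) (Σ<-cong (suc w) (λ m _ → swap-factors (falling w m) (suc m) (g (suc m)))) ⟩
  (g 0 + A) + Σ< (suc w) (λ m → suc m * falling w m * g (suc m))
    ≡⟨ cong (λ z → (g 0 + z) + Σ< (suc w) (λ m → suc m * falling w m * g (suc m))) (sym Bfix) ⟩
  (g 0 + Σ< (suc w) (λ m → falling w (suc m) * g (suc m))) + Σ< (suc w) (λ m → suc m * falling w m * g (suc m))
    ≡⟨ +-assoc (g 0) _ _ ⟩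
  g 0 + (Σ< (suc w) (λ m → falling w (suc m) * g (suc m)) + Σ< (suc w) (λ m → suc m * falling w m * g (suc m)))
    ≡⟨ cong (g 0 +_) (sym (Σ<-+ (suc w) (λ m → falling w (suc m) * g (suc m)) (λ m → suc m * falling w m * g (suc m)))) ⟩
  g 0 + Σ< (suc w) (λ m → falling w (suc m) * g (suc m) + suc m * falling w m * g (suc m))
    ≡⟨ cong₂ _+_ (sym (*-identityˡ (g 0))) (Σ<-cong (suc w) (λ m _ → trans (sym (*-distribʳ-+ (g (suc m)) (falling w (suc m)) (suc m * falling w m))) (cong (_* g (suc m)) (sym (falling-suc w m))))) ⟩
  1 * g 0 + Σ< (suc w) (λ m → falling (suc w) (suc m) * g (suc m)) ∎
  where
  A : ℕ
  A = Σ< w (λ m → falling w (suc m) * g (suc m))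
  swap-factors : ∀ f m x → f * (m * x) ≡ m * f * x
  swap-factors = solve-∀
  Bfix : Σ< (suc w) (λ m → falling w (suc m) * g (suc m)) ≡ A
  Bfix = trans (Σ<-last w _) (trans (cong (A +_) (cong (_* g (suc w)) (falling-0 w (suc w) ≤-refl))) (+-identityʳ A))

wordSum-factorial : ∀ w h → wordSum w (λ m → (w ∸ m) ! * h m) ≡ w ! * Σ< (suc w) h
wordSum-factorial w h = begin
  wordSum w (λ m → (w ∸ m) ! * h m)                     ≡⟨ wordSum-closed w (λ m → (w ∸ m) ! * h m) ⟩
  Σ< (suc w) (λ m → falling w m * ((w ∸ m) ! * h m))    ≡⟨ Σ<-cong (suc w) term≡ ⟩
  Σ< (suc w) (λ m → w ! * h m)                          ≡⟨ sym (Σ<-* (suc w) (w !) h) ⟩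
  w ! * Σ< (suc w) h                                    ∎
  where
  term≡ : ∀ m → m < suc w → falling w m * ((w ∸ m) ! * h m) ≡ w ! * h m
  term≡ m lt = trans (sym (*-assoc (falling w m) ((w ∸ m) !) (h m))) (cong (_* h m) (falling-factorial w m (≤-pred lt)))

wordSum-*ʳ : ∀ w g X → wordSum w g * X ≡ wordSum w (λ m → g m * X)
wordSum-*ʳ w g X = begin
  wordSum w g * X                               ≡⟨ cong (_* X) (wordSum-closed w g) ⟩
  Σ< (suc w) (λ m → falling w m * g m) * X      ≡⟨ *-comm (Σ< (suc w) (λ m → falling w m * g m)) X ⟩
  X * Σ< (suc w) (λ m → falling w m * g m)      ≡⟨ Σ<-* (suc w) X (λ m → falling w m * g m) ⟩
  Σ< (suc w) (λ m → X * (falling w m * g m))    ≡⟨ Σ<-cong (suc w) (λ m _ → rotate X (falling w m) (g m)) ⟩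
  Σ< (suc w) (λ m → falling w m * (g m * X))    ≡⟨ sym (wordSum-closed w (λ m → g m * X)) ⟩
  wordSum w (λ m → g m * X)                     ∎
  where
  rotate : ∀ X f g → X * (f * g) ≡ f * (g * X)
  rotate = solve-∀

-- The closed form of the theorem, with s = c + 1:
--   closedSum t v K = Σ_{j ≤ t} C(t,j) comp(v - cK + j, K + j) c^{t-j},
-- and the sums over the length of the first block that relate closedSum for
-- K and K + 1.
module ClosedForm (c : ℕ) where
  -- Pascal's rule applied termwise: the binomial transform with powers of c
  -- turns c E_j + E_{j+1} into a sum one step longer.
  binomial-step : ∀ t (E : ℕ → ℕ) → Σ< (suc t) (λ j → (t C j) * (c * E j + E (suc j)) * c ^ (t ∸ j))
                        ≡ Σ< (suc (suc t)) (λ j → (suc t C j) * E j * c ^ (suc t ∸ j))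
  binomial-step t E = begin
    Σ< (suc t) (λ j → (t C j) * (c * E j + E (suc j)) * c ^ (t ∸ j))
      ≡⟨ Σ<-cong (suc t) (λ j _ → distrib-+ (t C j) (c * E j) (E (suc j)) (c ^ (t ∸ j))) ⟩
    Σ< (suc t) (λ j → (t C j) * (c * E j) * c ^ (t ∸ j) + (t C j) * E (suc j) * c ^ (t ∸ j))
      ≡⟨ Σ<-+ (suc t) (λ j → (t C j) * (c * E j) * c ^ (t ∸ j)) (λ j → (t C j) * E (suc j) * c ^ (t ∸ j)) ⟩
    Σ< (suc t) (λ j → (t C j) * (c * E j) * c ^ (t ∸ j)) + S2
      ≡⟨ cong (_+ S2) L1 ⟩
    (1 * E 0 * c ^ (suc t) + S3) + S2
      ≡⟨ +-assoc (1 * E 0 * c ^ (suc t)) S3 S2 ⟩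
    1 * E 0 * c ^ (suc t) + (S3 + S2)
      ≡⟨ cong (1 * E 0 * c ^ (suc t) +_) (trans (+-comm S3 S2) (sym (Σ<-+ (suc t) (λ j → (t C j) * E (suc j) * c ^ (t ∸ j)) (λ j → (t C suc j) * E (suc j) * c ^ (t ∸ j))))) ⟩
    1 * E 0 * c ^ (suc t) + Σ< (suc t) (λ j → (t C j) * E (suc j) * c ^ (t ∸ j) + (t C suc j) * E (suc j) * c ^ (t ∸ j))
      ≡⟨ cong (1 * E 0 * c ^ (suc t) +_) (Σ<-cong (suc t) (λ j _ → trans (sym (distrib-+ˡ (t C j) (t C suc j) (E (suc j)) (c ^ (t ∸ j)))) (cong (λ z → z * E (suc j) * c ^ (t ∸ j)) (nCk+nC[k+1]≡[n+1]C[k+1] t j)))) ⟩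
    Σ< (suc (suc t)) (λ j → (suc t C j) * E j * c ^ (suc t ∸ j)) ∎
    where
    pull-c : ∀ c C e p → C * (c * e) * p ≡ C * e * (c * p)
    pull-c = solve-∀
    distrib-+ : ∀ C x y p → C * (x + y) * p ≡ C * x * p + C * y * p
    distrib-+ = solve-∀
    distrib-+ˡ : ∀ a b e p → (a + b) * e * p ≡ a * e * p + b * e * p
    distrib-+ˡ = solve-∀
    S2 S3 S3' : ℕ
    S2 = Σ< (suc t) (λ j → (t C j) * E (suc j) * c ^ (t ∸ j))
    S3 = Σ< (suc t) (λ j → (t C suc j) * E (suc j) * c ^ (t ∸ j))
    S3' = Σ< t (λ j → (t C suc j) * E (suc j) * c ^ (t ∸ j))
    S3≡ : S3 ≡ S3'
    S3≡ = trans (Σ<-last t _) (trans (cong (S3' +_) (cong (λ z → z * E (suc t) * c ^ (t ∸ t)) (k>n⇒nCk≡0 {t} {suc t} ≤-refl))) (+-identityʳ S3'))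
    L1 : Σ< (suc t) (λ j → (t C j) * (c * E j) * c ^ (t ∸ j)) ≡ 1 * E 0 * c ^ (suc t) + S3
    L1 = trans (cong₂ _+_ (pull-c c 1 (E 0) (c ^ t)) (Σ<-cong t shift))
               (cong (1 * E 0 * c ^ (suc t) +_) (sym S3≡))
      where
      shift : ∀ j → j < t → (t C suc j) * (c * E (suc j)) * c ^ (t ∸ suc j) ≡ (t C suc j) * E (suc j) * c ^ (t ∸ j)
      shift j lt = trans (pull-c c (t C suc j) (E (suc j)) (c ^ (t ∸ suc j)))
                         (cong (λ z → (t C suc j) * E (suc j) * c ^ z) (sym (∸≡suc∸suc t j lt)))

  -- a first block with m further elements has m + 1 places for its minimum,
  -- provided it has at least s = c + 1 elements
  weight : ℕ → ℕ
  weight m = if suc c ≤ᵇ suc m then suc m else 0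

  weight-small : ∀ m → m < c → weight m ≡ 0
  weight-small m lt with suc c ≤ᵇ suc m in e
  ... | true = ⊥-elim (<-irrefl refl (<-≤-trans lt (≤-pred (≤ᵇ⇒≤ (suc c) (suc m) (subst T (sym e) _)))))
  ... | false = refl

  weight-large : ∀ m → c ≤ m → weight m ≡ suc m
  weight-large m le with suc c ≤ᵇ suc m in e
  ... | true = refl
  ... | false = ⊥-elim (subst T e (≤⇒≤ᵇ (s≤s le)))

  ∸<⇒∸≤ : ∀ w t i → w ∸ suc t < i → w ∸ i ≤ t
  ∸<⇒∸≤ w t i lt = m≤n+o⇒m∸n≤o w i (≤-trans (m≤n+m∸n w (suc t)) (≤-trans (≤-reflexive (sym (+-suc t (w ∸ suc t)))) (≤-trans (+-monoʳ-≤ t lt) (≤-reflexive (+-comm t i)))))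

  comp-j : ∀ j K → comp j (suc K + j) ≡ 0
  comp-j j K = comp-0 j (suc K + j) (m<n+m j (s≤s z≤n))

  -- the j-th term of closedSum, with k lists, after choosing a first block
  -- with m further elements out of w
  firstBlockTerm : ℕ → ℕ → ℕ → ℕ → ℕ
  firstBlockTerm w k j m = weight m * comp ((w ∸ m) ∸ c * k + j) (k + j)

  -- m > w - t' contributes nothing (too few elements for the other blocks)
  Σ-firstBlock-truncate : ∀ w k j t' → t' ≤ k → Σ< (suc (w ∸ t')) (firstBlockTerm w k j) ≡ Σ< (suc w) (firstBlockTerm w k j)
  Σ-firstBlock-truncate w k j zero _ = refl
  Σ-firstBlock-truncate w k j (suc t) le = sym (Σ<-ext' (suc (w ∸ suc t)) (suc w) (firstBlockTerm w k j) (s≤s (m∸n≤m w (suc t))) z)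
    where z : ∀ i → suc (w ∸ suc t) ≤ i → i < suc w → firstBlockTerm w k j i ≡ 0
          z i l1 _ = trans (cong (weight i *_) (comp-0 ((w ∸ i) ∸ c * k + j) (k + j) bound)) (*-zeroʳ (weight i))
            where bound : (w ∸ i) ∸ c * k + j < k + j
                  bound = +-monoˡ-< j (≤-<-trans (m∸n≤m (w ∸ i) (c * k)) (≤-<-trans (∸<⇒∸≤ w t i l1) le))

  -- if w < c(k + 1) there is no room for the blocks at all
  Σ-firstBlock-small : ∀ w k j → w < c + c * k → Σ< (suc w) (firstBlockTerm w k j) ≡ 0
  Σ-firstBlock-small w k j lt = Σ<-0 (suc w) (firstBlockTerm w k j) z
    where z : ∀ i → i < suc w → firstBlockTerm w k j i ≡ 0
          z i li with i <? c
          ... | yes ic = cong (_* comp ((w ∸ i) ∸ c * k + j) (k + j)) (weight-small i ic)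
          ... | no nic = trans (cong (λ x → weight i * comp (x + j) (k + j)) e0) (trans (cong (weight i *_) (cz k refl)) (*-zeroʳ (weight i)))
            where
            c≤i : c ≤ i
            c≤i = ≮⇒≥ nic
            e0 : (w ∸ i) ∸ c * k ≡ 0
            e0 = m≤n⇒m∸n≡0 (≤-trans (∸-monoʳ-≤ w c≤i) (m≤n+o⇒m∸n≤o w c (<⇒≤ lt)))
            cz : ∀ k' → k' ≡ k → comp (0 + j) (k + j) ≡ 0
            cz zero refl = ⊥-elim (<-irrefl refl (<-≤-trans (<-≤-trans lt (≤-reflexive (trans (cong (c +_) (*-zeroʳ c)) (+-identityʳ c)))) (≤-trans c≤i (≤-pred li))))
            cz (suc k') refl = comp-j j k'

  -- Σ_{b ≤ N} (c + b + 1) comp (N - b + j) (k + j), evaluated with the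
  -- hockey-stick identities comp-sum and comp-weighted-sum.
  Σ-shifted-comp : ∀ N j k → Σ< (suc N) (λ b → suc (c + b) * comp ((N ∸ b) + j) (k + j))
                   ≡ c * comp (suc N + j) (suc k + j) + comp (suc N + suc j) (suc k + suc j)
  Σ-shifted-comp N j k = begin
    Σ< (suc N) g                      ≡⟨ Σ<-cong (suc N) (λ b lt → cong (λ z → suc (c + b) * comp z K) (sym (+-∸-comm j (≤-pred lt)))) ⟩
    Σ< (suc N) h                      ≡⟨ sym (Σ<-ext' (suc N) (suc X) h (s≤s (m≤m+n N j)) h-vanishes) ⟩
    Σ< (suc X) h                      ≡⟨ Σ<-cong (suc X) (λ b _ → split-weight c b (comp (X ∸ b) K)) ⟩
    Σ< (suc X) (λ b → c * comp (X ∸ b) K + suc b * comp (X ∸ b) K)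
      ≡⟨ Σ<-+ (suc X) (λ b → c * comp (X ∸ b) K) (λ b → suc b * comp (X ∸ b) K) ⟩
    Σ< (suc X) (λ b → c * comp (X ∸ b) K) + Σ< (suc X) (λ b → suc b * comp (X ∸ b) K)
      ≡⟨ cong₂ _+_ (trans (sym (Σ<-* (suc X) c (λ b → comp (X ∸ b) K))) (cong (c *_) (comp-sum X K))) (comp-weighted-sum X K) ⟩
    c * comp (suc X) (suc K) + comp (suc (suc X)) (suc (suc K))
      ≡⟨ cong₂ (λ a b → c * comp (suc X) (suc K) + comp (suc a) b) (sym (+-suc N j)) (cong suc (sym (+-suc k j))) ⟩
    c * comp (suc N + j) (suc k + j) + comp (suc N + suc j) (suc k + suc j) ∎
    where
    X K : ℕ
    X = N + j
    K = k + j
    g h : ℕ → ℕ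
    g b = suc (c + b) * comp ((N ∸ b) + j) K
    h b = suc (c + b) * comp (X ∸ b) K
    split-weight : ∀ c b y → suc (c + b) * y ≡ c * y + suc b * y
    split-weight = solve-∀
    -- beyond b = N the first argument X - b drops below j ≤ K
    h-vanishes : ∀ b → suc N ≤ b → b < suc X → h b ≡ 0
    h-vanishes b l1 l2 = trans (cong (suc (c + b) *_) (comp-0 (X ∸ b) K (<-≤-trans small (m≤n+m j k)))) (*-zeroʳ (suc (c + b)))
      where
      xb : X ∸ b + b ≡ X
      xb = m∸n+n≡m (≤-pred l2)
      small : X ∸ b < j
      small = +-cancelʳ-≤ N (suc (X ∸ b)) j (≤-trans (≤-reflexive (sym (+-suc (X ∸ b) N))) (≤-trans (+-monoʳ-≤ (X ∸ b) l1) (≤-reflexive (trans xb (+-comm N j)))))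

  -- When w ≥ c(k + 1) the terms with m < c vanish (weight), as do those with
  -- m > w - c - ck (too few elements left); the rest is Σ-shifted-comp.
  Σ-firstBlock-large : ∀ w k j → c + c * k ≤ w →
        Σ< (suc w) (firstBlockTerm w k j) ≡ c * comp (suc (w ∸ c ∸ c * k) + j) (suc k + j) + comp (suc (w ∸ c ∸ c * k) + suc j) (suc k + suc j)
  Σ-firstBlock-large w k j le = begin
    Σ< (suc w) f                      ≡⟨ cong (λ z → Σ< z f) e1 ⟩
    Σ< (c + suc X) f                  ≡⟨ Σ<-shift c (suc X) f (λ i lt → cong (_* comp ((w ∸ i) ∸ c * k + j) (k + j)) (weight-small i lt)) ⟩
    Σ< (suc X) (λ b → f (c + b))      ≡⟨ Σ<-cong (suc X) (λ b _ → shifted b) ⟩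
    Σ< (suc X) g                      ≡⟨ Σ<-ext' (suc N) (suc X) g (s≤s (m∸n≤m X (c * k))) g-vanishes ⟩
    Σ< (suc N) g                      ≡⟨ Σ-shifted-comp N j k ⟩
    c * comp (suc N + j) (suc k + j) + comp (suc N + suc j) (suc k + suc j) ∎
    where
    X N : ℕ
    X = w ∸ c
    N = X ∸ c * k
    f g : ℕ → ℕ
    f = firstBlockTerm w k j
    g b = suc (c + b) * comp ((N ∸ b) + j) (k + j)
    c≤w : c ≤ w
    c≤w = ≤-trans (m≤m+n c (c * k)) le
    e1 : suc w ≡ c + suc X
    e1 = sym (trans (+-suc c X) (cong suc (m+[n∸m]≡n c≤w)))
    shifted : ∀ b → f (c + b) ≡ g b
    shifted b = cong₂ _*_ (weight-large (c + b) (m≤m+n c b)) (cong (λ z → comp (z + j) (k + j)) e)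
      where e : (w ∸ (c + b)) ∸ c * k ≡ N ∸ b
            e = trans (cong (_∸ c * k) (sym (∸-+-assoc w c b))) (trans (∸-+-assoc X b (c * k)) (trans (cong (X ∸_) (+-comm b (c * k))) (sym (∸-+-assoc X (c * k) b))))
    g-vanishes : ∀ b → suc N ≤ b → b < suc X → g b ≡ 0
    g-vanishes b l1 l2 = trans (cong (λ x → suc (c + b) * comp (x + j) (k + j)) (m≤n⇒m∸n≡0 (≤-trans (n≤1+n N) l1))) (trans (cong (suc (c + b) *_) (cz k refl)) (*-zeroʳ (suc (c + b))))
      where cz : ∀ k' → k' ≡ k → comp (0 + j) (k + j) ≡ 0
            cz zero refl = ⊥-elim (<-irrefl refl (<-≤-trans (subst (_< b) (trans (cong (X ∸_) (*-zeroʳ c)) refl) l1) (≤-pred l2)))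
            cz (suc k') refl = comp-j j k'

  Σ-firstBlock : ∀ w k j t' → t' ≤ k → Σ< (suc (w ∸ t')) (firstBlockTerm w k j) ≡
       c * comp ((suc w ∸ c * suc k) + j) (suc k + j) + comp ((suc w ∸ c * suc k) + suc j) (suc k + suc j)
  Σ-firstBlock w k j t' tk with w <? c + c * k
  ... | yes lt = trans (Σ-firstBlock-truncate w k j t' tk) (trans (Σ-firstBlock-small w k j lt) (sym (trans (cong (λ z → c * comp (z + j) (suc k + j) + comp (z + suc j) (suc k + suc j)) eN)
                   (trans (cong₂ (λ x y → c * x + y) (comp-j j k) (comp-j (suc j) k)) (trans (+-identityʳ (c * 0)) (*-zeroʳ c))))))
    where eN : suc w ∸ c * suc k ≡ 0
          eN = m≤n⇒m∸n≡0 (subst (suc w ≤_) (sym (*-suc c k)) lt)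
  ... | no nlt = trans (Σ-firstBlock-truncate w k j t' tk) (trans (Σ-firstBlock-large w k j le) (cong (λ z → c * comp (z + j) (suc k + j) + comp (z + suc j) (suc k + suc j)) (sym eN)))
    where le : c + c * k ≤ w
          le = ≮⇒≥ nlt
          eN : suc w ∸ c * suc k ≡ suc (w ∸ c ∸ c * k)
          eN = trans (cong (suc w ∸_) (*-suc c k)) (trans (+-∸-assoc 1 le) (cong suc (sym (∸-+-assoc w c (c * k)))))

  closedTerm : ℕ → ℕ → ℕ → ℕ → ℕ
  closedTerm t v K j = (t C j) * comp (v ∸ c * K + j) (K + j) * c ^ (t ∸ j)

  closedSum : ℕ → ℕ → ℕ → ℕ
  closedSum t v K = Σ< (suc t) (closedTerm t v K)

  -- Summing over the first block turns closedSum for K into closedSum for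
  -- K + 1, with one more special element.
  closedSum-step : ∀ w k t' → t' ≤ k → Σ< (suc (w ∸ t')) (λ m → weight m * closedSum t' (w ∸ m) k) ≡ closedSum (suc t') (suc w) (suc k)
  closedSum-step w k t' tk = begin
    Σ< M (λ m → weight m * closedSum t' (w ∸ m) k)
      ≡⟨ Σ<-cong M (λ m _ → Σ<-* (suc t') (weight m) (closedTerm t' (w ∸ m) k)) ⟩
    Σ< M (λ m → Σ< (suc t') (λ j → weight m * closedTerm t' (w ∸ m) k j))
      ≡⟨ Σ<-swap M (suc t') (λ m j → weight m * closedTerm t' (w ∸ m) k j) ⟩
    Σ< (suc t') (λ j → Σ< M (λ m → weight m * closedTerm t' (w ∸ m) k j))
      ≡⟨ Σ<-cong (suc t') (λ j _ → inner j) ⟩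
    Σ< (suc t') (λ j → (t' C j) * (c * E j + E (suc j)) * c ^ (t' ∸ j))
      ≡⟨ binomial-step t' E ⟩
    closedSum (suc t') (suc w) (suc k) ∎
    where
    M : ℕ
    M = suc (w ∸ t')
    E : ℕ → ℕ
    E j = comp ((suc w ∸ c * suc k) + j) (suc k + j)
    regroup : ∀ W C x p → W * (C * x * p) ≡ C * p * (W * x)
    regroup = solve-∀
    swap₂₃ : ∀ C p S → C * p * S ≡ C * S * p
    swap₂₃ = solve-∀
    inner : ∀ j → Σ< M (λ m → weight m * closedTerm t' (w ∸ m) k j) ≡ (t' C j) * (c * E j + E (suc j)) * c ^ (t' ∸ j)
    inner j = trans (Σ<-cong M (λ m _ → regroup (weight m) (t' C j) (comp ((w ∸ m) ∸ c * k + j) (k + j)) (c ^ (t' ∸ j))))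
               (trans (sym (Σ<-* M ((t' C j) * c ^ (t' ∸ j)) (firstBlockTerm w k j)))
                 (trans (swap₂₃ (t' C j) (c ^ (t' ∸ j)) _) (cong (λ z → (t' C j) * z * c ^ (t' ∸ j)) (Σ-firstBlock w k j t' tk))))

  closedSum-0 : ∀ v K → closedSum 0 v K ≡ comp (v ∸ c * K) K
  closedSum-0 v K = trans (unit (comp (v ∸ c * K + 0) (K + 0))) (cong₂ comp (+-identityʳ (v ∸ c * K)) (+-identityʳ K))
    where
    unit : ∀ x → 1 * x * 1 + 0 ≡ x
    unit = solve-∀

  closedSum-1 : ∀ v K → closedSum 1 v K ≡ comp (v ∸ c * K) K * c + comp (suc (v ∸ c * K)) (suc K)
  closedSum-1 v K = trans (cong (λ z → 1 * comp (v ∸ c * K + 0) (K + 0) * (c * 1) + (z * comp (v ∸ c * K + 1) (K + 1) * 1 + 0)) (nCn≡1 1))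
             (trans (unit c (comp (v ∸ c * K + 0) (K + 0)) (comp (v ∸ c * K + 1) (K + 1)))
               (cong₂ (λ x y → x * c + y) (cong₂ comp (+-identityʳ (v ∸ c * K)) (+-identityʳ K)) (cong₂ comp (+-comm _ 1) (+-comm K 1))))
    where
    unit : ∀ c x y → 1 * x * (c * 1) + (1 * y * 1 + 0) ≡ x * c + y
    unit = solve-∀

  -- The case without special elements: k + 1 ways to choose which block is
  -- first are compensated by the absorption identity.
  closedSum-step₀ : ∀ w k → suc k * closedSum 1 (suc w) (suc k) ≡ suc w * closedSum 0 (suc w) (suc k)
  closedSum-step₀ w k = trans (cong (suc k *_) (closedSum-1 (suc w) (suc k))) (trans main (sym (cong (suc w *_) (closedSum-0 (suc w) (suc k)))))
    where
    v K N a b : ℕ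
    v = suc w
    K = suc k
    N = v ∸ c * K
    a = comp N K
    b = comp (suc N) (suc K)
    distrib : ∀ K c a b → K * (a * c + b) ≡ K * c * a + K * b
    distrib = solve-∀
    collect : ∀ K c a N → K * c * a + N * a ≡ (N + c * K) * a
    collect = solve-∀
    main : K * (a * c + b) ≡ v * a
    main with c * K ≤? v
    ... | yes le = trans (distrib K c a b) (trans (cong (K * c * a +_) kb) (trans (collect K c a N) (cong (_* a) (m∸n+n≡m le))))
      where
      kb : K * b ≡ N * a
      kb with N
      ... | zero = trans (cong (K *_) (k>n⇒nCk≡0 {0} {suc k} (s≤s z≤n))) (*-zeroʳ K)
      ... | suc N'' = absorption N'' k
    ... | no nle = trans (cong (λ z → K * (z * c + b)) a0) (trans (cong (λ z → K * (0 * c + z)) b0) (trans (*-zeroʳ K) (sym (trans (cong (v *_) a0) (*-zeroʳ v)))))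
      where
      N0 : N ≡ 0
      N0 = m≤n⇒m∸n≡0 (<⇒≤ (≰⇒> nle))
      a0 : a ≡ 0
      a0 = cong (λ z → comp z K) N0
      b0 : b ≡ 0
      b0 = trans (cong (λ z → comp (suc z) (suc K)) N0) (k>n⇒nCk≡0 {0} {suc k} (s≤s z≤n))

module ClosedFormProof (c : ℕ) where
  open ClosedForm c

  F : ℕ → ℕ → ℕ → ℕ
  F = partitionCount (suc c)

  Closed : ℕ → ℕ → ℕ → Set
  Closed k v t = F v t k * (k ∸ t) ! ≡ (v ∸ t) ! * closedSum t v k

  -- For t ≥ 1 the recursion of partitionCount is a wordSum; its closed form
  -- (wordSum-factorial) followed by closedSum-step gives the claim.
  closed-step : ∀ k w t → t ≤ k → (∀ v → Closed k v t) → Closed (suc k) (suc w) (suc t)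
  closed-step k w t t≤k IH = begin
    wordSum w′ g * X                                              ≡⟨ wordSum-*ʳ w′ g X ⟩
    wordSum w′ (λ m → g m * X)                                    ≡⟨ wordSum-cong w′ _ _ term≡ ⟩
    wordSum w′ (λ m → (w′ ∸ m) ! * (weight m * closedSum t (w ∸ m) k)) ≡⟨ wordSum-factorial w′ (λ m → weight m * closedSum t (w ∸ m) k) ⟩
    w′ ! * Σ< (suc w′) (λ m → weight m * closedSum t (w ∸ m) k)   ≡⟨ cong (w′ ! *_) (closedSum-step w k t t≤k) ⟩
    w′ ! * closedSum (suc t) (suc w) (suc k)                       ∎
    where
    w′ X : ℕ
    w′ = w ∸ t
    X = (k ∸ t) !
    g : ℕ → ℕ
    g m = if suc c ≤ᵇ suc m then suc m * F (w ∸ m) t k else 0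
    ∸-swap : ∀ m → (w ∸ m) ∸ t ≡ w′ ∸ m
    ∸-swap m = trans (∸-+-assoc w m t) (trans (cong (w ∸_) (+-comm m t)) (sym (∸-+-assoc w t m)))
    pull : ∀ m A Y → suc m * (A * Y) ≡ A * (suc m * Y)
    pull = solve-∀
    term≡ : ∀ m → g m * X ≡ (w′ ∸ m) ! * (weight m * closedSum t (w ∸ m) k)
    term≡ m with suc c ≤ᵇ suc m
    ... | true = begin
      suc m * F (w ∸ m) t k * X                          ≡⟨ *-assoc (suc m) (F (w ∸ m) t k) X ⟩
      suc m * (F (w ∸ m) t k * X)                        ≡⟨ cong (suc m *_) (IH (w ∸ m)) ⟩
      suc m * ((w ∸ m ∸ t) ! * closedSum t (w ∸ m) k)    ≡⟨ cong (λ z → suc m * (z ! * closedSum t (w ∸ m) k)) (∸-swap m) ⟩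
      suc m * ((w′ ∸ m) ! * closedSum t (w ∸ m) k)       ≡⟨ pull m ((w′ ∸ m) !) (closedSum t (w ∸ m) k) ⟩
      (w′ ∸ m) ! * (suc m * closedSum t (w ∸ m) k)       ∎
    ... | false = sym (*-zeroʳ ((w′ ∸ m) !))

  -- For t = 0 the counts for t = 0 and t = 1 coincide, and the extra factor
  -- k + 1 is absorbed by closedSum-step₀.
  closed-zero : ∀ k w → Closed (suc k) (suc w) 1 → Closed (suc k) (suc w) 0
  closed-zero k w closed₁ = begin
    P * (suc k * k !)                           ≡⟨ move₁ P k (k !) ⟩
    suc k * (P * k !)                           ≡⟨ cong (suc k *_) closed₁ ⟩
    suc k * (w ! * closedSum 1 (suc w) (suc k)) ≡⟨ move₂ k (w !) (closedSum 1 (suc w) (suc k)) ⟩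
    w ! * (suc k * closedSum 1 (suc w) (suc k)) ≡⟨ cong (w ! *_) (closedSum-step₀ w k) ⟩
    w ! * (suc w * closedSum 0 (suc w) (suc k)) ≡⟨ move₃ (w !) w (closedSum 0 (suc w) (suc k)) ⟩
    (suc w) ! * closedSum 0 (suc w) (suc k)     ∎
    where
    P : ℕ
    P = F (suc w) 0 (suc k)
    move₁ : ∀ P k K → P * (suc k * K) ≡ suc k * (P * K)
    move₁ = solve-∀
    move₂ : ∀ k W Y → suc k * (W * Y) ≡ W * (suc k * Y)
    move₂ = solve-∀
    move₃ : ∀ W w Y → W * (suc w * Y) ≡ (W + w * W) * Y
    move₃ = solve-∀

  partitionCount-closed : ∀ k v t → t ≤ k → Closed k v t
  partitionCount-closed zero zero zero z≤n = sym (trans (+-identityʳ (closedSum 0 0 0)) (trans (closedSum-0 0 0) (cong (λ z → comp (0 ∸ z) 0) (*-zeroʳ c))))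
  partitionCount-closed zero (suc v) zero z≤n = sym (trans (cong ((suc v) ! *_) (trans (closedSum-0 (suc v) 0) (cong (λ z → comp (suc v ∸ z) 0) (*-zeroʳ c)))) (*-zeroʳ ((suc v) !)))
  partitionCount-closed (suc k) zero t le = sym (trans (cong ((0 ∸ t) ! *_) (Σ<-0 (suc t) (closedTerm t 0 (suc k)) z)) (*-zeroʳ ((0 ∸ t) !)))
    where z : ∀ j → j < suc t → closedTerm t 0 (suc k) j ≡ 0
          z j _ = trans (cong (λ x → (t C j) * x * c ^ (t ∸ j)) (trans (cong (λ y → comp (y + j) (suc k + j)) (0∸n≡0 (c * suc k))) (comp-j j k)))
                    (cong (_* c ^ (t ∸ j)) (*-zeroʳ (t C j)))
  partitionCount-closed (suc k) (suc w) zero _ = closed-zero k w (closed-step k w 0 z≤n (λ v → partitionCount-closed k v 0 z≤n))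
  partitionCount-closed (suc k) (suc w) (suc t) le = closed-step k w t (≤-pred le) (λ v → partitionCount-closed k v t (≤-pred le))

sumTo≡Σ< : ∀ r f → sumTo r f ≡ Σ< (suc r) f
sumTo≡Σ< r f = go (suc r) (λ i → i)
  where
  go : ∀ m g → sum (map f (applyUpTo g m)) ≡ Σ< m (λ i → f (g i))
  go zero g = refl
  go (suc m) g = cong (f (g 0) +_) (go m (λ i → g (suc i)))

-- Rewriting the argument of the compositions count in the shape of the paper:
-- for m > x, the first argument m - x + j is 1 + (m + j - x - 1).
∸+≡suc : ∀ m x j → x < m → m ∸ x + j ≡ suc (m + j ∸ x ∸ 1)
∸+≡suc m x j x<m = begin
  m ∸ x + j             ≡⟨ sym (+-∸-comm j (<⇒≤ x<m)) ⟩
  m + j ∸ x             ≡⟨ sym (suc-∸1 (≤-trans (m<n⇒0<n∸m x<m) (∸-monoˡ-≤ x (m≤m+n m j)))) ⟩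
  suc (m + j ∸ x ∸ 1)   ∎
  where
  suc-∸1 : ∀ {y} → 1 ≤ y → suc (y ∸ 1) ≡ y
  suc-∸1 {suc y} _ = refl

-- The sum of the theorem is closedSum, once the compositions are written
-- as binomial coefficients.
closedSum≡sumTo : ∀ c r n k′ → c * suc k′ < n →
  ClosedForm.closedSum c r n (suc k′) ≡
  sumTo r (λ j → ((r C j) * ((n + j ∸ c * suc k′ ∸ 1) C (suc k′ + j ∸ 1))) * c ^ (r ∸ j))
closedSum≡sumTo c r n k′ ck<n = trans
  (Σ<-cong (suc r) (λ j _ → cong (λ x → (r C j) * comp x (suc k′ + j) * c ^ (r ∸ j)) (∸+≡suc n (c * suc k′) j ck<n)))
  (sym (sumTo≡Σ< r _))

mainTheorem7 : (s r k n : ℕ) → 1 ≤ s → (r ⊔ 1) ≤ k → s * k ≤ n →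
    Fin ((((n ∸ r) ! * sumTo r (λ j → ((r C j) * ((n + j ∸ (s ∸ 1) * k ∸ 1) C (k + j ∸ 1))) * (s ∸ 1) ^ (r ∸ j))) / ((k ∸ r) !)) {{(k ∸ r) !≢0}})
    ↔ LSet s r n k
mainTheorem7 zero r k n () r⊔1≤k sk≤n
mainTheorem7 (suc c) r zero n _ r⊔1≤k sk≤n with () ← ≤-trans (m≤n⊔m r 1) r⊔1≤k
mainTheorem7 (suc c) r k@(suc k′) n _ r⊔1≤k sk≤n =
  ↔-trans (Fin-cong size≡) (↔-sym (WholeSet.LSet↔partitionCount (suc c) r n r≤n k))
  where
  instance
    nonZero : NonZero ((k ∸ r) !)
    nonZero = (k ∸ r) !≢0
  r≤k : r ≤ k
  r≤k = ≤-trans (m≤m⊔n r 1) r⊔1≤k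
  ck<n : c * k < n
  ck<n = ≤-trans (s≤s (m≤n+m (c * k) k′)) sk≤n
  r≤n : r ≤ n
  r≤n = ≤-trans r≤k (≤-trans (m≤m+n k (c * k)) sk≤n)
  size≡ : (n ∸ r) ! * sumTo r _ / (k ∸ r) ! ≡ partitionCount (suc c) n r k
  size≡ = begin
    (n ∸ r) ! * sumTo r _ / (k ∸ r) !                        ≡⟨ /-congˡ (cong ((n ∸ r) ! *_) (sym (closedSum≡sumTo c r n k′ ck<n))) ⟩
    (n ∸ r) ! * ClosedForm.closedSum c r n k / (k ∸ r) !      ≡⟨ /-congˡ (sym (ClosedFormProof.partitionCount-closed c k n r r≤k)) ⟩
    partitionCount (suc c) n r k * (k ∸ r) ! / (k ∸ r) !      ≡⟨ m*n/n≡m (partitionCount (suc c) n r k) ((k ∸ r) !) ⟩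
    partitionCount (suc c) n r k                              ∎
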